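{- Let $(u_n)_{n\ge0}$ be the Rudin–Shapiro sequence defined by $u_0=0$, $u_{2n}=u_n$, $u_{4n+1}=u_n$, $u_{4n+3}=1-u_{2n+1}$ for $n\ge0$, and let $$f_1(x)=\sum_{n\ge0}u_{n+1}x^n,\quad f_2(x)=\sum_{n\ge0}u_{n+2}x^n,\quad f_3(x)=\sum_{n\ge0}u_{n+3}x^n.$$ Then $$H(f_1)\equiv(1,0,0,1,0,0,1,0,0,1,1,1,0,0,0,0,1,1)^*\pmod 2,$$ $$H(f_2)\equiv(1,0,1,1,0,1,1,0,1,1,1,1,0,0,0,1,1,1)^*\pmod 2,$$ $$H(f_3)\equiv(1,1,0,1,1,1,1,1,1,0,1,1,0,0,1,0,1,0)^*\pmod 2.$$
   Context: For a power series $f=\sum_{i\ge0}a_ix^i$ and $n\ge1$, $H_n(f)=\det(a_{i+j})_{0\le i,j\le n-1}$, $H_0(f)=1$, and $H(f)=(H_0(f),H_1(f),\dots)$. The notation $(w)^*$ denotes the infinite sequence obtained by repeating the finite block $w$ forever, starting at index $0$; congruence of sequences mod 2 is termwise. -}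

module Defs where

open import Data.Nat as ℕ using (ℕ; zero; suc)
open import Data.Integer using (ℤ; +_; _+_; _*_; -_; 0ℤ; 1ℤ)
open import Data.Fin using (Fin; zero; suc; toℕ; punchIn)
open import Data.Vec using (Vec; lookup)
open import Data.Nat.DivMod using (_%_; m%n<n)
open import Data.Fin using (fromℕ<)

Σᶠ : (n : ℕ) → (Fin n → ℤ) → ℤ
Σᶠ zero    f = 0ℤ
Σᶠ (suc n) f = f zero + Σᶠ n (λ j → f (suc j))

sign : ℕ → ℤ
sign zero    = 1ℤ
sign (suc k) = - sign k

det : (n : ℕ) → (Fin n → Fin n → ℤ) → ℤ
det zero    M = 1ℤ
det (suc n) M =
  Σᶠ (suc n) (λ j → sign (toℕ j) * (M zero j * det n (λ i k → M (suc i) (punchIn j k))))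

-- Hankel determinant H_n(f) of the power series f = Σ a_i x^i (given by its
-- coefficient sequence a); H_0 = 1 by det 0 = 1.
H : (ℕ → ℤ) → ℕ → ℤ
H a n = det n (λ i j → a (toℕ i ℕ.+ toℕ j))

periodic : {k : ℕ} → Vec ℕ (suc k) → ℕ → ℕ
periodic {k} w n = lookup w (fromℕ< (m%n<n n (suc k)))

{-# OPTIONS --safe #-}
-- Over 𝔽₂ the Hankel determinants of a power series are read off its Hankel continued fraction
-- (Han): if d a = xᵏ with d = 1 + … + x^(k+2) g, then H(a) = (1, 0, …, 0, H(g)) with k zeros.
-- Mod 2 the Rudin–Shapiro series T = Σ u(n+3) xⁿ satisfies (x³ + x⁴ + x⁷ + x⁸) T² = (1 + x⁴) T + 1,
-- so every series met in the continued fractions of f₁, f₂, f₃ has the form (P T + Q) / N.  They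
-- fall into 33 nodes, each step of the expansion being a polynomial identity checked by evaluation,
-- and the resulting finite automaton produces the sequences H(fᵢ) mod 2, of period 18.

module Submission where

open import Defs
open import Data.Nat using (ℕ; _+_; _*_)
open import Data.Integer using (ℤ; +_; _-_; 1ℤ; 0ℤ; _%ℕ_)
open import Data.Vec using (_∷_; [])
open import Data.Product using (_×_)
open import Relation.Binary.PropositionalEquality using (_≡_)

open import Function using (_∘_)
open import Algebra.Bundles using (CommutativeRing; CommutativeMonoid)
open import Data.Bool using (Bool; true; false; _∧_; _xor_; not; if_then_else_)
open import Data.Bool.Properties
  using ( xor-assoc; xor-comm; xor-identityʳ; xor-same; xor-annihilates-not
        ; ∧-comm; ∧-assoc; ∧-identityʳ; ∧-zeroʳ; ∧-distribˡ-xor; ∧-distribʳ-xor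
        ; xor-∧-commutativeRing; ∧-commutativeMonoid)
import Data.Bool.Properties as Boolₚ
open import Data.Nat as ℕ using (zero; suc; ⌊_/2⌋; _∸_; _≤_; _<_; z≤n; s≤s; _≡ᵇ_; _<?_; _≤?_)
import Data.Nat.Properties as ℕₚ
open import Data.Nat.DivMod using (_%_; [m+kn]%n≡m%n; m<n⇒m%n≡m; %-distribˡ-+; m%n%n≡m%n; m%n<n)
open import Data.Nat.Induction using (<-rec)
open import Data.Nat.Tactic.RingSolver using (solve-∀)
import Data.Integer as ℤ
import Data.Integer.Properties as ℤₚ
open import Data.Fin using (Fin; zero; suc; toℕ; punchIn; punchOut; fromℕ<; _↑ʳ_; #_)
open import Data.Fin.Properties
  using ( _≟_; toℕ-injective; toℕ-fromℕ<; toℕ-↑ʳ; toℕ<n; all?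
        ; punchIn-injective; punchInᵢ≢i; punchIn-punchOut; punchOut-injective)
open import Data.Fin.Permutation as Perm using (Permutation; _⟨$⟩ʳ_; remove; transpose)
open import Data.List using (List; []; _∷_; replicate; _++_; length; map)
open import Data.Vec using (Vec; lookup)
open import Data.Product using (_,_)
open import Data.Empty using (⊥-elim)
open import Relation.Binary.PropositionalEquality
  using (refl; sym; trans; cong; cong₂; subst; _≢_; _≗_; module ≡-Reasoning)
open import Relation.Nullary using (¬_; yes; no; does; Dec)
open import Relation.Nullary.Decidable using (dec-true; dec-false; toWitness; True)

open import Algebra.Properties.Semiring.Sum (CommutativeRing.semiring xor-∧-commutativeRing)
  using (sum; sum-cong-≗; sum-remove; sum-permute; ∑-distrib-+; ∑-comm; *-distribˡ-sum; sum-replicate-zero)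
open import Algebra.Properties.CommutativeSemigroup
  (CommutativeRing.+-commutativeSemigroup xor-∧-commutativeRing)
  using () renaming (interchange to xor-interchange; x∙yz≈y∙xz to xor-lcomm)
open import Algebra.Properties.CommutativeSemigroup
  (CommutativeMonoid.commutativeSemigroup ∧-commutativeMonoid)
  using () renaming (x∙yz≈y∙xz to ∧-lcomm)

xor-moveʳ : ∀ a b c → a xor b ≡ c → a ≡ c xor b
xor-moveʳ a b c a⊕b≡c = begin
  a                ≡⟨ sym (xor-identityʳ a) ⟩
  a xor false      ≡⟨ cong (a xor_) (sym (xor-same b)) ⟩
  a xor (b xor b)  ≡⟨ sym (xor-assoc a b b) ⟩
  (a xor b) xor b  ≡⟨ cong (_xor b) a⊕b≡c ⟩
  c xor b          ∎
  where open ≡-Reasoning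

sum-false : ∀ {n} (f : Fin n → Bool) → (∀ i → f i ≡ false) → sum f ≡ false
sum-false {n} f f≡false = trans (sum-cong-≗ f≡false) (sum-replicate-zero n)

sum-single : ∀ {n} (f : Fin n → Bool) i → (∀ j → j ≢ i → f j ≡ false) → sum f ≡ f i
sum-single {suc n} f i vanish = begin
  sum f                                 ≡⟨ sum-remove {i = i} f ⟩
  f i xor sum (λ j → f (punchIn i j))   ≡⟨ cong (f i xor_) (sum-false _ (λ j → vanish _ (punchInᵢ≢i i j))) ⟩
  f i xor false                         ≡⟨ xor-identityʳ (f i) ⟩
  f i                                   ∎
  where open ≡-Reasoning

sum-pair : ∀ {n} (f : Fin (suc n) → Bool) i j → i ≢ j → (∀ c → c ≢ i → c ≢ j → f c ≡ false) →
           sum f ≡ f i xor f j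
sum-pair f i j i≢j vanish = begin
  sum f                                 ≡⟨ sum-remove {i = i} f ⟩
  f i xor sum (λ c → f (punchIn i c))   ≡⟨ cong (f i xor_) (sum-single _ (punchOut i≢j) vanish′) ⟩
  f i xor f (punchIn i (punchOut i≢j))  ≡⟨ cong (λ c → f i xor f c) (punchIn-punchOut i≢j) ⟩
  f i xor f j                           ∎
  where
  open ≡-Reasoning
  vanish′ : ∀ c → c ≢ punchOut i≢j → f (punchIn i c) ≡ false
  vanish′ c c≢ = vanish _ (punchInᵢ≢i i c)
    (λ eq → c≢ (punchIn-injective i c _ (trans eq (sym (punchIn-punchOut i≢j)))))

Matrix : ℕ → Set
Matrix n = Fin n → Fin n → Bool

minor : ∀ {n} → Matrix (suc n) → Fin (suc n) → Matrix n
minor M j i k = M (suc i) (punchIn j k)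

det₂ : (n : ℕ) → Matrix n → Bool
det₂ zero    M = true
det₂ (suc n) M = sum (λ j → M zero j ∧ det₂ n (minor M j))

det₂-cong : ∀ n {M N : Matrix n} → (∀ i j → M i j ≡ N i j) → det₂ n M ≡ det₂ n N
det₂-cong zero    M≡N = refl
det₂-cong (suc n) M≡N =
  sum-cong-≗ (λ j → cong₂ _∧_ (M≡N zero j) (det₂-cong n (λ i k → M≡N (suc i) (punchIn j k))))

det₂-permuteColumns : ∀ n (M : Matrix n) (π : Permutation n n) →
                      det₂ n (λ i k → M i (π ⟨$⟩ʳ k)) ≡ det₂ n M
det₂-permuteColumns zero    M π = refl
det₂-permuteColumns (suc n) M π =
  trans (sum-cong-≗ (λ c → cong (M zero (π ⟨$⟩ʳ c) ∧_)
          (trans (det₂-cong n (λ i k → cong (M (suc i)) (Perm.punchIn-permute π c k)))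
                 (det₂-permuteColumns n (minor M (π ⟨$⟩ʳ c)) (remove c π)))))
        (sym (sum-permute (λ d → M zero d ∧ det₂ n (minor M d)) π))

transpose-applyˡ : ∀ {n} (i j : Fin n) → transpose i j ⟨$⟩ʳ i ≡ j
transpose-applyˡ i j with i ≟ i
... | yes _  = refl
... | no i≢i = ⊥-elim (i≢i refl)

transpose-equalColumns : ∀ {m n} (M : Fin m → Fin n → Bool) i j → (∀ r → M r i ≡ M r j) →
                         ∀ r x → M r (transpose i j ⟨$⟩ʳ x) ≡ M r x
transpose-equalColumns M i j eq r x with x ≟ i
... | yes refl = sym (eq r)
... | no _ with x ≟ j
...   | yes refl = eq r
...   | no _     = refl

det₂-equalColumns : ∀ n (M : Matrix n) i j → i ≢ j → (∀ r → M r i ≡ M r j) → det₂ n M ≡ false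
det₂-equalColumns (suc n) M i j i≢j eq = begin
  det₂ (suc n) M
    ≡⟨ sum-pair _ i j i≢j otherTerm ⟩
  M zero i ∧ det₂ n (minor M i) xor M zero j ∧ det₂ n (minor M j)
    ≡⟨ cong₂ (λ a b → a ∧ b xor M zero j ∧ det₂ n (minor M j)) (eq zero) minors-agree ⟩
  M zero j ∧ det₂ n (minor M j) xor M zero j ∧ det₂ n (minor M j)
    ≡⟨ xor-same (M zero j ∧ det₂ n (minor M j)) ⟩
  false ∎
  where
  open ≡-Reasoning
  otherTerm : ∀ c → c ≢ i → c ≢ j → M zero c ∧ det₂ n (minor M c) ≡ false
  otherTerm c c≢i c≢j = trans (cong (M zero c ∧_)
    (det₂-equalColumns n (minor M c) (punchOut c≢i) (punchOut c≢j)
      (i≢j ∘ punchOut-injective c≢i c≢j)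
      (λ r → trans (cong (M (suc r)) (punchIn-punchOut c≢i))
               (trans (eq (suc r)) (cong (M (suc r)) (sym (punchIn-punchOut c≢j)))))))
    (∧-zeroʳ _)
  -- Exchanging columns i and j of M maps the minor at i onto the minor at j, up to reordering.
  minors-agree : det₂ n (minor M i) ≡ det₂ n (minor M j)
  minors-agree = trans (sym (det₂-cong n λ r k →
      trans (cong (λ z → M (suc r) (punchIn z (remove i (transpose i j) ⟨$⟩ʳ k))) (sym (transpose-applyˡ i j)))
        (trans (cong (M (suc r)) (sym (Perm.punchIn-permute (transpose i j) i k)))
          (transpose-equalColumns M i j eq (suc r) (punchIn i k)))))
    (det₂-permuteColumns n (minor M j) (remove i (transpose i j)))

replaceColumn : ∀ {n} → Matrix n → Fin n → (Fin n → Bool) → Matrix n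
replaceColumn M j v r c = if does (c ≟ j) then v r else M r c

module _ {n : ℕ} (M : Matrix n) (j : Fin n) (v : Fin n → Bool) where

  replaceColumn-at : ∀ r → replaceColumn M j v r j ≡ v r
  replaceColumn-at r with j ≟ j
  ... | yes _  = refl
  ... | no j≢j = ⊥-elim (j≢j refl)

  replaceColumn-other : ∀ r c → c ≢ j → replaceColumn M j v r c ≡ M r c
  replaceColumn-other r c c≢j with c ≟ j
  ... | yes c≡j = ⊥-elim (c≢j c≡j)
  ... | no _    = refl

laplaceTerm : ∀ {n} → Matrix (suc n) → Fin (suc n) → Bool
laplaceTerm {n} M c = M zero c ∧ det₂ n (minor M c)

module _ {n : ℕ} (M : Matrix (suc n)) (j : Fin (suc n)) (v : Fin (suc n) → Bool) where

  laplaceTerm-replacedColumn : laplaceTerm (replaceColumn M j v) j ≡ v zero ∧ det₂ n (minor M j)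
  laplaceTerm-replacedColumn = cong₂ _∧_ (replaceColumn-at M j v zero)
    (det₂-cong n (λ r k → replaceColumn-other M j v (suc r) (punchIn j k) (punchInᵢ≢i j k)))

  laplaceTerm-otherColumn : ∀ c (c≢j : c ≢ j) → laplaceTerm (replaceColumn M j v) c
    ≡ M zero c ∧ det₂ n (replaceColumn (minor M c) (punchOut c≢j) (v ∘ suc))
  laplaceTerm-otherColumn c c≢j =
    cong₂ _∧_ (replaceColumn-other M j v zero c c≢j) (det₂-cong n minors)
    where
    minors : ∀ r k → replaceColumn M j v (suc r) (punchIn c k)
                     ≡ replaceColumn (minor M c) (punchOut c≢j) (v ∘ suc) r k
    minors r k with punchIn c k ≟ j | k ≟ punchOut c≢j
    ... | yes _  | yes _  = refl
    ... | no _   | no _   = refl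
    ... | yes eq | no k≢  = ⊥-elim (k≢ (punchIn-injective c _ _ (trans eq (sym (punchIn-punchOut c≢j)))))
    ... | no ≢j  | yes eq = ⊥-elim (≢j (trans (cong (punchIn c) eq) (punchIn-punchOut c≢j)))

det₂-replaceColumn-xor : ∀ n (M : Matrix n) j v w →
  det₂ n (replaceColumn M j (λ r → v r xor w r)) ≡ det₂ n (replaceColumn M j v) xor det₂ n (replaceColumn M j w)
det₂-replaceColumn-xor (suc n) M j v w =
  trans (sum-cong-≗ term) (∑-distrib-+ (laplaceTerm (replaceColumn M j v)) (laplaceTerm (replaceColumn M j w)))
  where
  term : ∀ c → laplaceTerm (replaceColumn M j (λ r → v r xor w r)) c
             ≡ laplaceTerm (replaceColumn M j v) c xor laplaceTerm (replaceColumn M j w) c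
  termCase : ∀ c → Dec (c ≡ j) → laplaceTerm (replaceColumn M j (λ r → v r xor w r)) c
             ≡ laplaceTerm (replaceColumn M j v) c xor laplaceTerm (replaceColumn M j w) c
  term c = termCase c (c ≟ j)
  termCase c (yes refl) = begin
    _                                                        ≡⟨ laplaceTerm-replacedColumn M c (λ r → v r xor w r) ⟩
    (v zero xor w zero) ∧ det₂ n (minor M c)                 ≡⟨ ∧-distribʳ-xor _ (v zero) (w zero) ⟩
    v zero ∧ det₂ n (minor M c) xor w zero ∧ det₂ n (minor M c)
      ≡⟨ sym (cong₂ _xor_ (laplaceTerm-replacedColumn M c v) (laplaceTerm-replacedColumn M c w)) ⟩
    _                                                        ∎
    where open ≡-Reasoning
  termCase c (no c≢j) = begin
    _  ≡⟨ laplaceTerm-otherColumn M j (λ r → v r xor w r) c c≢j ⟩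
    M zero c ∧ det₂ n (replaceColumn (minor M c) (punchOut c≢j) (λ r → v (suc r) xor w (suc r)))
       ≡⟨ cong (M zero c ∧_) (det₂-replaceColumn-xor n (minor M c) (punchOut c≢j) (v ∘ suc) (w ∘ suc)) ⟩
    M zero c ∧ (det₂ n (replaceColumn (minor M c) (punchOut c≢j) (v ∘ suc))
                xor det₂ n (replaceColumn (minor M c) (punchOut c≢j) (w ∘ suc)))
       ≡⟨ ∧-distribˡ-xor (M zero c) _ _ ⟩
    _  ≡⟨ sym (cong₂ _xor_ (laplaceTerm-otherColumn M j v c c≢j) (laplaceTerm-otherColumn M j w c c≢j)) ⟩
    _  ∎
    where open ≡-Reasoning

det₂-replaceColumn-∧ : ∀ n (M : Matrix n) j b v →
  det₂ n (replaceColumn M j (λ r → b ∧ v r)) ≡ b ∧ det₂ n (replaceColumn M j v)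
det₂-replaceColumn-∧ (suc n) M j b v =
  trans (sum-cong-≗ term) (sym (*-distribˡ-sum b (laplaceTerm (replaceColumn M j v))))
  where
  term : ∀ c → laplaceTerm (replaceColumn M j (λ r → b ∧ v r)) c ≡ b ∧ laplaceTerm (replaceColumn M j v) c
  termCase : ∀ c → Dec (c ≡ j) →
             laplaceTerm (replaceColumn M j (λ r → b ∧ v r)) c ≡ b ∧ laplaceTerm (replaceColumn M j v) c
  term c = termCase c (c ≟ j)
  termCase c (yes refl) = trans (laplaceTerm-replacedColumn M c (λ r → b ∧ v r))
    (trans (∧-assoc b (v zero) _) (cong (b ∧_) (sym (laplaceTerm-replacedColumn M c v))))
  termCase c (no c≢j) = trans (laplaceTerm-otherColumn M j (λ r → b ∧ v r) c c≢j)
    (trans (cong (M zero c ∧_) (det₂-replaceColumn-∧ n (minor M c) (punchOut c≢j) b (v ∘ suc)))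
      (trans (∧-lcomm (M zero c) b _) (cong (b ∧_) (sym (laplaceTerm-otherColumn M j v c c≢j)))))

det₂-replaceColumn-sum : ∀ n m (M : Matrix n) j (f : Fin m → Fin n → Bool) →
  det₂ n (replaceColumn M j (λ r → sum (λ i → f i r))) ≡ sum (λ i → det₂ n (replaceColumn M j (f i)))
det₂-replaceColumn-sum n zero    M j f = det₂-replaceColumn-∧ n M j false (λ _ → false)
det₂-replaceColumn-sum n (suc m) M j f =
  trans (det₂-replaceColumn-xor n M j (f zero) (λ r → sum (λ i → f (suc i) r)))
        (cong (det₂ n (replaceColumn M j (f zero)) xor_) (det₂-replaceColumn-sum n m M j (f ∘ suc)))

det₂-replaceColumn-same : ∀ n (M : Matrix n) j → det₂ n (replaceColumn M j (λ r → M r j)) ≡ det₂ n M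
det₂-replaceColumn-same n M j = det₂-cong n same
  where
  same : ∀ r c → replaceColumn M j (λ r → M r j) r c ≡ M r c
  same r c with c ≟ j
  ... | yes refl = refl
  ... | no _     = refl

det₂-replaceColumn-copy : ∀ n (M : Matrix n) j i → i ≢ j → det₂ n (replaceColumn M j (λ r → M r i)) ≡ false
det₂-replaceColumn-copy n M j i i≢j = det₂-equalColumns n _ i j i≢j
  (λ r → trans (replaceColumn-other M j (λ r → M r i) r i i≢j) (sym (replaceColumn-at M j (λ r → M r i) r)))

det₂-addColumns : ∀ n (M : Matrix n) j (c : Fin n → Bool) → c j ≡ false →
  det₂ n (replaceColumn M j (λ r → M r j xor sum (λ i → c i ∧ M r i))) ≡ det₂ n M
det₂-addColumns n M j c cj≡false = begin
  det₂ n (replaceColumn M j (λ r → M r j xor sum (λ i → c i ∧ M r i)))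
    ≡⟨ det₂-replaceColumn-xor n M j _ _ ⟩
  det₂ n (replaceColumn M j (λ r → M r j)) xor det₂ n (replaceColumn M j (λ r → sum (λ i → c i ∧ M r i)))
    ≡⟨ cong₂ _xor_ (det₂-replaceColumn-same n M j) (det₂-replaceColumn-sum n n M j (λ i r → c i ∧ M r i)) ⟩
  det₂ n M xor sum (λ i → det₂ n (replaceColumn M j (λ r → c i ∧ M r i)))
    ≡⟨ cong (det₂ n M xor_) (sum-false _ added) ⟩
  det₂ n M xor false
    ≡⟨ xor-identityʳ _ ⟩
  det₂ n M ∎
  where
  open ≡-Reasoning
  added : ∀ i → det₂ n (replaceColumn M j (λ r → c i ∧ M r i)) ≡ false
  added i with i ≟ j
  ... | yes refl = trans (det₂-replaceColumn-∧ n M i (c i) (λ r → M r i)) (cong (_∧ _) cj≡false)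
  ... | no i≢j   = trans (det₂-replaceColumn-∧ n M j (c i) (λ r → M r i))
                     (trans (cong (c i ∧_) (det₂-replaceColumn-copy n M j i i≢j)) (∧-zeroʳ (c i)))

∑∧∑-comm : ∀ {m n} (a : Fin m → Bool) (b : Fin n → Bool) (X : Fin n → Fin m → Bool) →
  sum (λ c → a c ∧ sum (λ r → b r ∧ X r c)) ≡ sum (λ r → b r ∧ sum (λ c → a c ∧ X r c))
∑∧∑-comm a b X =
  trans (sum-cong-≗ (λ c → trans (*-distribˡ-sum (a c) (λ r → b r ∧ X r c))
                               (sum-cong-≗ (λ r → ∧-lcomm (a c) (b r) (X r c)))))
  (trans (∑-comm (λ c r → b r ∧ (a c ∧ X r c)))
    (sum-cong-≗ (λ r → sym (*-distribˡ-sum (b r) (λ c → a c ∧ X r c)))))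

det₂-firstColumnExpansion : ∀ n (M : Matrix (suc n)) →
  det₂ (suc n) M ≡ sum (λ r → M r zero ∧ det₂ n (λ i k → M (punchIn r i) (suc k)))
det₂-firstColumnExpansion zero    M = refl
det₂-firstColumnExpansion (suc n) M =
  cong ((M zero zero ∧ det₂ (suc n) (λ i k → M (suc i) (suc k))) xor_)
    (trans (sum-cong-≗ (λ c → cong (M zero (suc c) ∧_) (det₂-firstColumnExpansion n (minor M (suc c)))))
      (∑∧∑-comm (λ c → M zero (suc c)) (λ r → M (suc r) zero)
        (λ r c → det₂ n (λ i k → M (suc (punchIn r i)) (suc (punchIn c k))))))

det₂-transpose : ∀ n (M : Matrix n) → det₂ n (λ i j → M j i) ≡ det₂ n M
det₂-transpose zero    M = refl
det₂-transpose (suc n) M =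
  trans (sum-cong-≗ (λ c → cong (M c zero ∧_) (det₂-transpose n (λ i k → M (punchIn c i) (suc k)))))
        (sym (det₂-firstColumnExpansion n M))

module _ (n : ℕ) (M V : Matrix n) (V-diag : ∀ j → V j j ≡ true)
         (V-lower : ∀ i j → toℕ j < toℕ i → V i j ≡ false) where

  private
    MV : Matrix n
    MV r j = sum (λ i → M r i ∧ V i j)

    mixed : ℕ → Matrix n
    mixed t r j = if does (toℕ j <? t) then M r j else MV r j

    mixed-before : ∀ {t r j} → toℕ j < t → mixed t r j ≡ M r j
    mixed-before {t} {r} {j} lt = cong (if_then M r j else MV r j) (dec-true (toℕ j <? t) lt)

    mixed-from : ∀ {t r j} → ¬ toℕ j < t → mixed t r j ≡ MV r j
    mixed-from {t} {r} {j} ≮ = cong (if_then M r j else MV r j) (dec-false (toℕ j <? t) ≮)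

    mixed-suc : ∀ {t r j} → toℕ j ≢ t → mixed t r j ≡ mixed (suc t) r j
    mixed-suc {t} {r} {j} ≢t = byCases (toℕ j <? t)
      where
      byCases : Dec (toℕ j < t) → mixed t r j ≡ mixed (suc t) r j
      byCases (yes lt) = trans (mixed-before lt) (sym (mixed-before (ℕₚ.m<n⇒m<1+n lt)))
      byCases (no ≮)  = trans (mixed-from ≮) (sym (mixed-from (λ lt → ≮ (ℕₚ.≤∧≢⇒< (ℕₚ.≤-pred lt) ≢t))))

    module _ (t : ℕ) (t<n : t < n) where

      jt : Fin n
      jt = fromℕ< t<n

      toℕ-jt : toℕ jt ≡ t
      toℕ-jt = toℕ-fromℕ< t<n

      coeff : Fin n → Bool
      coeff i = does (toℕ i <? t) ∧ V i jt

      coeff-jt : coeff jt ≡ false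
      coeff-jt = cong (_∧ V jt jt) (dec-false (toℕ jt <? t) (ℕₚ.<-irrefl toℕ-jt))

      offDiagonal : ∀ {r} i → i ≢ jt → M r i ∧ V i jt ≡ coeff i ∧ mixed (suc t) r i
      offDiagonal {r} i i≢jt = byCases (toℕ i <? t)
        where
        jt<i : ¬ toℕ i < t → toℕ jt < toℕ i
        jt<i ≮ = subst (_< toℕ i) (sym toℕ-jt)
          (ℕₚ.≤∧≢⇒< (ℕₚ.≮⇒≥ ≮) (λ t≡i → i≢jt (toℕ-injective (trans (sym t≡i) (sym toℕ-jt)))))
        byCases : Dec (toℕ i < t) → M r i ∧ V i jt ≡ coeff i ∧ mixed (suc t) r i
        byCases (yes lt) = trans (∧-comm (M r i) (V i jt))
          (cong₂ _∧_ (cong (_∧ V i jt) (sym (dec-true (toℕ i <? t) lt))) (sym (mixed-before (ℕₚ.m<n⇒m<1+n lt))))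
        byCases (no ≮) = trans (cong (M r i ∧_) (V-lower i jt (jt<i ≮))) (trans (∧-zeroʳ (M r i))
          (cong (λ b → (b ∧ V i jt) ∧ mixed (suc t) r i) (sym (dec-false (toℕ i <? t) ≮))))

      column-jt : ∀ r → MV r jt ≡ M r jt xor sum (λ i → coeff i ∧ mixed (suc t) r i)
      column-jt r = xor-moveʳ (MV r jt) S (M r jt) (begin
        MV r jt xor S
          ≡⟨ sym (∑-distrib-+ (λ i → M r i ∧ V i jt) (λ i → coeff i ∧ mixed (suc t) r i)) ⟩
        sum (λ i → M r i ∧ V i jt xor coeff i ∧ mixed (suc t) r i)
          ≡⟨ sum-single _ jt (λ i i≢jt → trans (cong (_xor (coeff i ∧ mixed (suc t) r i)) (offDiagonal i i≢jt))
                                                (xor-same (coeff i ∧ mixed (suc t) r i))) ⟩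
        M r jt ∧ V jt jt xor coeff jt ∧ mixed (suc t) r jt
          ≡⟨ cong₂ _xor_ (trans (cong (M r jt ∧_) (V-diag jt)) (∧-identityʳ _)) (cong (_∧ mixed (suc t) r jt) coeff-jt) ⟩
        M r jt xor false
          ≡⟨ xor-identityʳ _ ⟩
        M r jt ∎)
        where
        open ≡-Reasoning
        S = sum (λ i → coeff i ∧ mixed (suc t) r i)

      mixed≡replaced : ∀ r j → mixed t r j
        ≡ replaceColumn (mixed (suc t)) jt (λ r → mixed (suc t) r jt xor sum (λ i → coeff i ∧ mixed (suc t) r i)) r j
      mixed≡replaced r j with j ≟ jt
      ... | yes refl = trans (mixed-from (ℕₚ.<-irrefl toℕ-jt))
          (trans (column-jt r) (cong (_xor sum (λ i → coeff i ∧ mixed (suc t) r i))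
            (sym (mixed-before (subst (_< suc t) (sym toℕ-jt) (ℕₚ.n<1+n t))))))
      ... | no j≢jt  = mixed-suc (λ j≡t → j≢jt (toℕ-injective (trans j≡t (sym toℕ-jt))))

      mixed-step : det₂ n (mixed t) ≡ det₂ n (mixed (suc t))
      mixed-step = trans (det₂-cong n mixed≡replaced) (det₂-addColumns n (mixed (suc t)) jt coeff coeff-jt)

    det₂-mixed : ∀ d t → t + d ≡ n → det₂ n (mixed t) ≡ det₂ n M
    det₂-mixed zero    t t≡n = det₂-cong n (λ r j →
      mixed-before (subst (toℕ j <_) (sym (trans (sym (ℕₚ.+-identityʳ t)) t≡n)) (toℕ<n j)))
    det₂-mixed (suc d) t t+d≡n =
      trans (mixed-step t (subst (t <_) t+d≡n (ℕₚ.m<m+n t (s≤s z≤n))))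
            (det₂-mixed d (suc t) (trans (sym (ℕₚ.+-suc t d)) t+d≡n))

  det₂-mulUnitriangular : det₂ n (λ r j → sum (λ i → M r i ∧ V i j)) ≡ det₂ n M
  det₂-mulUnitriangular = det₂-mixed n zero refl

Series : Set
Series = ℕ → Bool

Σ< : ℕ → Series → Bool
Σ< zero    f = false
Σ< (suc n) f = f 0 xor Σ< n (f ∘ suc)

conv : Series → Series → Series
conv f g m = Σ< (suc m) (λ i → f i ∧ g (m ∸ i))

Σ<-cong : ∀ n {f g : Series} → (∀ i → i < n → f i ≡ g i) → Σ< n f ≡ Σ< n g
Σ<-cong zero    f≡g = refl
Σ<-cong (suc n) f≡g = cong₂ _xor_ (f≡g 0 (s≤s z≤n)) (Σ<-cong n (λ i lt → f≡g (suc i) (s≤s lt)))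

Σ<-false : ∀ n (f : Series) → (∀ i → i < n → f i ≡ false) → Σ< n f ≡ false
Σ<-false n f f≡false = trans (Σ<-cong n f≡false) (Σ<-constFalse n)
  where
  Σ<-constFalse : ∀ n → Σ< n (λ _ → false) ≡ false
  Σ<-constFalse zero    = refl
  Σ<-constFalse (suc n) = Σ<-constFalse n

Σ<-+ : ∀ p q (f : Series) → Σ< (p + q) f ≡ Σ< p f xor Σ< q (λ i → f (p + i))
Σ<-+ zero    q f = refl
Σ<-+ (suc p) q f = trans (cong (f 0 xor_) (Σ<-+ p q (f ∘ suc))) (sym (xor-assoc (f 0) _ _))

Σ<-xor : ∀ n (f g : Series) → Σ< n (λ i → f i xor g i) ≡ Σ< n f xor Σ< n g
Σ<-xor zero    f g = refl
Σ<-xor (suc n) f g = trans (cong ((f 0 xor g 0) xor_) (Σ<-xor n (f ∘ suc) (g ∘ suc)))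
                           (xor-interchange (f 0) (g 0) _ _)

Σ<-∧ : ∀ n c (f : Series) → Σ< n (λ i → c ∧ f i) ≡ c ∧ Σ< n f
Σ<-∧ zero    c f = sym (∧-zeroʳ c)
Σ<-∧ (suc n) c f = trans (cong ((c ∧ f 0) xor_) (Σ<-∧ n c (f ∘ suc))) (sym (∧-distribˡ-xor c _ _))

sum≡Σ< : ∀ n (f : Series) → sum {n} (λ i → f (toℕ i)) ≡ Σ< n f
sum≡Σ< zero    f = refl
sum≡Σ< (suc n) f = cong (f 0 xor_) (sum≡Σ< n (f ∘ suc))

Σ<-truncate : ∀ p q (f : Series) → (∀ i → p ≤ i → f i ≡ false) → Σ< (p + q) f ≡ Σ< p f
Σ<-truncate p q f vanish = trans (Σ<-+ p q f)
  (trans (cong (Σ< p f xor_) (Σ<-false q _ (λ i _ → vanish (p + i) (ℕₚ.m≤m+n p i)))) (xor-identityʳ _))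

conv-comm : ∀ m (f g : Series) → conv f g m ≡ conv g f m
conv-comm zero          f g = cong (_xor false) (∧-comm (f 0) (g 0))
conv-comm (suc zero)    f g = begin
  f 0 ∧ g 1 xor (f 1 ∧ g 0 xor false)  ≡⟨ cong (f 0 ∧ g 1 xor_) (xor-identityʳ _) ⟩
  f 0 ∧ g 1 xor f 1 ∧ g 0              ≡⟨ cong₂ _xor_ (∧-comm (f 0) (g 1)) (∧-comm (f 1) (g 0)) ⟩
  g 1 ∧ f 0 xor g 0 ∧ f 1              ≡⟨ xor-comm (g 1 ∧ f 0) (g 0 ∧ f 1) ⟩
  g 0 ∧ f 1 xor g 1 ∧ f 0              ≡⟨ cong (g 0 ∧ f 1 xor_) (sym (xor-identityʳ _)) ⟩
  g 0 ∧ f 1 xor (g 1 ∧ f 0 xor false)  ∎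
  where open ≡-Reasoning
conv-comm (suc (suc m)) f g =
  trans (cong ((f 0 ∧ g (2 + m)) xor_) (trans (conv-comm (suc m) (f ∘ suc) g)
    (cong ((g 0 ∧ f (2 + m)) xor_) (conv-comm m (g ∘ suc) (f ∘ suc)))))
  (trans (xor-lcomm (f 0 ∧ g (2 + m)) (g 0 ∧ f (2 + m)) _)
   (sym (cong ((g 0 ∧ f (2 + m)) xor_) (conv-comm (suc m) (g ∘ suc) f))))

infixl 6 _⊕_
_⊕_ : Series → Series → Series
(f ⊕ g) m = f m xor g m

0ₛ : Series
0ₛ _ = false

shift : Series → Series
shift s zero    = false
shift s (suc m) = s m

scale : Bool → Series → Series
scale c s m = c ∧ s m

conv-headˡ : ∀ f g m → conv f g m ≡ (f 0 ∧ g m) xor shift (conv (f ∘ suc) g) m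
conv-headˡ f g zero    = refl
conv-headˡ f g (suc m) = refl

conv-cong : ∀ {f f′ g g′} → f ≗ f′ → g ≗ g′ → conv f g ≗ conv f′ g′
conv-cong {f} {f′} {g} {g′} f≗f′ g≗g′ m =
  Σ<-cong (suc m) {λ i → f i ∧ g (m ∸ i)} {λ i → f′ i ∧ g′ (m ∸ i)} (λ i _ → cong₂ _∧_ (f≗f′ i) (g≗g′ (m ∸ i)))

conv-congˡ : ∀ {f f′} g → f ≗ f′ → conv f g ≗ conv f′ g
conv-congˡ {f} {f′} g f≗f′ = conv-cong {f} {f′} {g} {g} f≗f′ (λ _ → refl)

conv-congʳ : ∀ f {g g′} → g ≗ g′ → conv f g ≗ conv f g′
conv-congʳ f {g} {g′} g≗g′ = conv-cong {f} {f} {g} {g′} (λ _ → refl) g≗g′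

conv-congʳ-upTo : ∀ f g g′ m → (∀ i → i ≤ m → g i ≡ g′ i) → conv f g m ≡ conv f g′ m
conv-congʳ-upTo f g g′ m g≡g′ = Σ<-cong (suc m) (λ i _ → cong (f i ∧_) (g≡g′ (m ∸ i) (ℕₚ.m∸n≤m m i)))

conv-zeroˡ : ∀ g → conv 0ₛ g ≗ 0ₛ
conv-zeroˡ g m = Σ<-false (suc m) _ (λ _ _ → refl)

conv-zeroʳ : ∀ f → conv f 0ₛ ≗ 0ₛ
conv-zeroʳ f m = Σ<-false (suc m) _ (λ i _ → ∧-zeroʳ (f i))

conv-distribʳ-⊕ : ∀ f g h → conv (f ⊕ g) h ≗ conv f h ⊕ conv g h
conv-distribʳ-⊕ f g h m = trans (Σ<-cong (suc m) (λ i _ → ∧-distribʳ-xor (h (m ∸ i)) (f i) (g i)))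
                                (Σ<-xor (suc m) (λ i → f i ∧ h (m ∸ i)) (λ i → g i ∧ h (m ∸ i)))

conv-distribˡ-⊕ : ∀ f g h → conv f (g ⊕ h) ≗ conv f g ⊕ conv f h
conv-distribˡ-⊕ f g h m = trans (Σ<-cong (suc m) (λ i _ → ∧-distribˡ-xor (f i) (g (m ∸ i)) (h (m ∸ i))))
                                (Σ<-xor (suc m) (λ i → f i ∧ g (m ∸ i)) (λ i → f i ∧ h (m ∸ i)))

conv-scaleˡ : ∀ c g h → conv (scale c g) h ≗ scale c (conv g h)
conv-scaleˡ c g h m = trans (Σ<-cong (suc m) (λ i _ → ∧-assoc c (g i) (h (m ∸ i))))
                            (Σ<-∧ (suc m) c (λ i → g i ∧ h (m ∸ i)))

conv-shiftˡ : ∀ g h → conv (shift g) h ≗ shift (conv g h)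
conv-shiftˡ g h zero    = refl
conv-shiftˡ g h (suc m) = refl

conv-assoc : ∀ f g h → conv (conv f g) h ≗ conv f (conv g h)
conv-assoc f g h m = begin
  conv (conv f g) h m
    ≡⟨ conv-congˡ h (conv-headˡ f g) m ⟩
  conv (scale (f 0) g ⊕ shift (conv (f ∘ suc) g)) h m
    ≡⟨ conv-distribʳ-⊕ (scale (f 0) g) (shift (conv (f ∘ suc) g)) h m ⟩
  conv (scale (f 0) g) h m xor conv (shift (conv (f ∘ suc) g)) h m
    ≡⟨ cong₂ _xor_ (conv-scaleˡ (f 0) g h m) (conv-shiftˡ (conv (f ∘ suc) g) h m) ⟩
  (f 0 ∧ conv g h m) xor shift (conv (conv (f ∘ suc) g) h) m
    ≡⟨ cong ((f 0 ∧ conv g h m) xor_) (shifted m) ⟩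
  (f 0 ∧ conv g h m) xor shift (conv (f ∘ suc) (conv g h)) m
    ≡⟨ sym (conv-headˡ f (conv g h) m) ⟩
  conv f (conv g h) m ∎
  where
  open ≡-Reasoning
  shifted : ∀ m → shift (conv (conv (f ∘ suc) g) h) m ≡ shift (conv (f ∘ suc) (conv g h)) m
  shifted zero    = refl
  shifted (suc m) = conv-assoc (f ∘ suc) g h m

conv-lcomm : ∀ f g h → conv f (conv g h) ≗ conv g (conv f h)
conv-lcomm f g h m = trans (sym (conv-assoc f g h m))
  (trans (conv-congˡ h (λ i → conv-comm i f g) m) (conv-assoc g f h m))

Poly : Set
Poly = List Bool

⟦_⟧ : Poly → Series
⟦ []    ⟧ m       = false
⟦ b ∷ p ⟧ zero    = b
⟦ b ∷ p ⟧ (suc m) = ⟦ p ⟧ m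

addP : Poly → Poly → Poly
addP []      q       = q
addP (a ∷ p) []      = a ∷ p
addP (a ∷ p) (b ∷ q) = (a xor b) ∷ addP p q

mulP : Poly → Poly → Poly
mulP []      q = []
mulP (a ∷ p) q = addP (map (a ∧_) q) (false ∷ mulP p q)

one : Poly
one = true ∷ []

xPow : ℕ → Poly
xPow j = replicate j false ++ one

isZero : Poly → Bool
isZero []          = true
isZero (false ∷ p) = isZero p
isZero (true ∷ p)  = false

⟦addP⟧ : ∀ p q → ⟦ addP p q ⟧ ≗ ⟦ p ⟧ ⊕ ⟦ q ⟧
⟦addP⟧ []      q       m       = refl
⟦addP⟧ (a ∷ p) []      zero    = sym (xor-identityʳ a)
⟦addP⟧ (a ∷ p) []      (suc m) = sym (xor-identityʳ _)
⟦addP⟧ (a ∷ p) (b ∷ q) zero    = refl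
⟦addP⟧ (a ∷ p) (b ∷ q) (suc m) = ⟦addP⟧ p q m

⟦map-∧⟧ : ∀ c q → ⟦ map (c ∧_) q ⟧ ≗ scale c ⟦ q ⟧
⟦map-∧⟧ c []      m       = sym (∧-zeroʳ c)
⟦map-∧⟧ c (b ∷ q) zero    = refl
⟦map-∧⟧ c (b ∷ q) (suc m) = ⟦map-∧⟧ c q m

⟦mulP⟧ : ∀ p q → ⟦ mulP p q ⟧ ≗ conv ⟦ p ⟧ ⟦ q ⟧
⟦mulP⟧ []      q m = sym (conv-zeroˡ ⟦ q ⟧ m)
⟦mulP⟧ (a ∷ p) q m = trans (⟦addP⟧ (map (a ∧_) q) (false ∷ mulP p q) m)
  (trans (cong₂ _xor_ (⟦map-∧⟧ a q m) (shifted m)) (sym (conv-headˡ ⟦ a ∷ p ⟧ ⟦ q ⟧ m)))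
  where
  shifted : ∀ m → ⟦ false ∷ mulP p q ⟧ m ≡ shift (conv ⟦ p ⟧ ⟦ q ⟧) m
  shifted zero    = refl
  shifted (suc m) = ⟦mulP⟧ p q m

⟦xPow⟧ : ∀ j m → ⟦ xPow j ⟧ m ≡ (m ≡ᵇ j)
⟦xPow⟧ zero    zero    = refl
⟦xPow⟧ zero    (suc m) = refl
⟦xPow⟧ (suc j) zero    = refl
⟦xPow⟧ (suc j) (suc m) = ⟦xPow⟧ j m

⟦⟧-beyondLength : ∀ p i → length p ≤ i → ⟦ p ⟧ i ≡ false
⟦⟧-beyondLength []      i       _         = refl
⟦⟧-beyondLength (b ∷ p) (suc i) (s≤s len≤i) = ⟦⟧-beyondLength p i len≤i

isZero-sound : ∀ p → isZero p ≡ true → ⟦ p ⟧ ≗ 0ₛ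
isZero-sound []          _  m       = refl
isZero-sound (false ∷ p) _  zero    = refl
isZero-sound (false ∷ p) eq (suc m) = isZero-sound p eq m

xor≡false⇒≡ : ∀ {a b} → a xor b ≡ false → a ≡ b
xor≡false⇒≡ {false} {false} _ = refl
xor≡false⇒≡ {true}  {true}  _ = refl

isZero-addP-sound : ∀ p q → isZero (addP p q) ≡ true → ⟦ p ⟧ ≗ ⟦ q ⟧
isZero-addP-sound p q eq m = xor≡false⇒≡ (trans (sym (⟦addP⟧ p q m)) (isZero-sound (addP p q) eq m))

conv-identityˡ : ∀ f → conv ⟦ one ⟧ f ≗ f
conv-identityˡ f m = trans (conv-headˡ ⟦ one ⟧ f m) (trans (cong (f m xor_) (tail m)) (xor-identityʳ (f m)))
  where
  tail : ∀ m → shift (conv ⟦ [] ⟧ f) m ≡ false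
  tail zero    = refl
  tail (suc m) = conv-zeroˡ f m

conv-identityʳ : ∀ f → conv f ⟦ one ⟧ ≗ f
conv-identityʳ f m = trans (conv-comm m f ⟦ one ⟧) (conv-identityˡ f m)

conv-xPow : ∀ j g m → conv ⟦ xPow j ⟧ g (j + m) ≡ g m
conv-xPow zero    g m = conv-identityˡ g m
conv-xPow (suc j) g m = conv-xPow j g m

conv-cancelˡ-zero : ∀ p → isZero p ≡ false → ∀ z → conv ⟦ p ⟧ z ≗ 0ₛ → z ≗ 0ₛ
conv-cancelˡ-zero (false ∷ p) nonzero z pz≗0 = conv-cancelˡ-zero p nonzero z (pz≗0 ∘ suc)
conv-cancelˡ-zero (true ∷ p)  _       z pz≗0 m = below (suc m) m ℕₚ.≤-refl
  where
  next : ∀ m → (∀ i → i < m → z i ≡ false) → z m ≡ false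
  next m earlier = begin
    z m                                        ≡⟨ sym (xor-identityʳ (z m)) ⟩
    z m xor false                              ≡⟨ cong (z m xor_) (sym (tail m earlier)) ⟩
    (true ∧ z m) xor shift (conv ⟦ p ⟧ z) m    ≡⟨ sym (conv-headˡ ⟦ true ∷ p ⟧ z m) ⟩
    conv ⟦ true ∷ p ⟧ z m                      ≡⟨ pz≗0 m ⟩
    false                                      ∎
    where
    open ≡-Reasoning
    tail : ∀ m → (∀ i → i < m → z i ≡ false) → shift (conv ⟦ p ⟧ z) m ≡ false
    tail zero    _       = refl
    tail (suc m) earlier = trans (conv-congʳ-upTo ⟦ p ⟧ z 0ₛ m (λ i i≤m → earlier i (s≤s i≤m))) (conv-zeroʳ ⟦ p ⟧ m)
  below : ∀ n i → i < n → z i ≡ false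
  below (suc n) i (s≤s i≤n) with i <? n
  ... | yes i<n = below n i i<n
  ... | no  i≮n with ℕₚ.≤-antisym i≤n (ℕₚ.≮⇒≥ i≮n)
  ...   | refl = next i (below i)

conv-cancelˡ : ∀ p → isZero p ≡ false → ∀ x y → conv ⟦ p ⟧ x ≗ conv ⟦ p ⟧ y → x ≗ y
conv-cancelˡ p nonzero x y px≗py m = xor≡false⇒≡ (conv-cancelˡ-zero p nonzero (x ⊕ y) difference m)
  where
  difference : conv ⟦ p ⟧ (x ⊕ y) ≗ 0ₛ
  difference m = trans (conv-distribˡ-⊕ ⟦ p ⟧ x y m)
    (trans (cong (_xor conv ⟦ p ⟧ y m) (px≗py m)) (xor-same (conv ⟦ p ⟧ y m)))

-- Long division by 1 + x r; coefficient m + 1 of the quotient only needs coefficients up to m,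
-- so fuel m + 1 suffices for coefficient m.
divideFuel : Poly → Series → ℕ → Series
divideFuel r s zero    m       = false
divideFuel r s (suc f) zero    = s 0
divideFuel r s (suc f) (suc m) = s (suc m) xor conv ⟦ r ⟧ (divideFuel r s f) m

divide : Poly → Series → Series
divide r s m = divideFuel r s (suc m) m

divideFuel-stable : ∀ r s n i → i < n → ∀ f f′ → i < f → i < f′ → divideFuel r s f i ≡ divideFuel r s f′ i
divideFuel-stable r s (suc n) zero    _         (suc f) (suc f′) _         _          = refl
divideFuel-stable r s (suc n) (suc i) (s≤s i<n) (suc f) (suc f′) (s≤s i<f) (s≤s i<f′) =
  cong (s (suc i) xor_) (conv-congʳ-upTo ⟦ r ⟧ (divideFuel r s f) (divideFuel r s f′) i
    (λ j j≤i → divideFuel-stable r s n j (ℕₚ.≤-<-trans j≤i i<n) f f′ (ℕₚ.≤-<-trans j≤i i<f) (ℕₚ.≤-<-trans j≤i i<f′)))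

conv-divide : ∀ r s → conv ⟦ true ∷ r ⟧ (divide r s) ≗ s
conv-divide r s zero    = xor-identityʳ (s 0)
conv-divide r s (suc m) = begin
  (s (suc m) xor conv ⟦ r ⟧ (divideFuel r s (suc m)) m) xor conv ⟦ r ⟧ (divide r s) m
    ≡⟨ cong (λ z → (s (suc m) xor z) xor conv ⟦ r ⟧ (divide r s) m) stable ⟩
  (s (suc m) xor conv ⟦ r ⟧ (divide r s) m) xor conv ⟦ r ⟧ (divide r s) m
    ≡⟨ xor-assoc (s (suc m)) _ _ ⟩
  s (suc m) xor (conv ⟦ r ⟧ (divide r s) m xor conv ⟦ r ⟧ (divide r s) m)
    ≡⟨ cong (s (suc m) xor_) (xor-same (conv ⟦ r ⟧ (divide r s) m)) ⟩
  s (suc m) xor false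
    ≡⟨ xor-identityʳ _ ⟩
  s (suc m) ∎
  where
  open ≡-Reasoning
  stable : conv ⟦ r ⟧ (divideFuel r s (suc m)) m ≡ conv ⟦ r ⟧ (divide r s) m
  stable = conv-congʳ-upTo ⟦ r ⟧ (divideFuel r s (suc m)) (divide r s) m
    (λ j j≤m → divideFuel-stable r s (suc m) j (s≤s j≤m) (suc m) (suc j) (s≤s j≤m) (s≤s ℕₚ.≤-refl))

xPow*1+x : ℕ → Poly → Poly
xPow*1+x j r = replicate j false ++ (true ∷ r)

conv-divide-xPow : ∀ j r s → (∀ i → i < j → s i ≡ false) →
                   conv ⟦ xPow*1+x j r ⟧ (divide r (λ m → s (j + m))) ≗ s
conv-divide-xPow zero    r s _      = conv-divide r s
conv-divide-xPow (suc j) r s s<j≡0 zero    = sym (s<j≡0 0 (s≤s z≤n))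
conv-divide-xPow (suc j) r s s<j≡0 (suc m) =
  conv-divide-xPow j r (s ∘ suc) (λ i i<j → s<j≡0 (suc i) (s≤s i<j)) m

hankel₂ : Series → ℕ → Bool
hankel₂ a n = det₂ n (λ i j → a (toℕ i + toℕ j))

≡ᵇ-true : ∀ m n → m ≡ n → (m ≡ᵇ n) ≡ true
≡ᵇ-true zero    zero    _  = refl
≡ᵇ-true (suc m) (suc n) eq = ≡ᵇ-true m n (ℕₚ.suc-injective eq)

≡ᵇ-false : ∀ m n → m ≢ n → (m ≡ᵇ n) ≡ false
≡ᵇ-false zero    zero    m≢n = ⊥-elim (m≢n refl)
≡ᵇ-false zero    (suc n) _   = refl
≡ᵇ-false (suc m) zero    _   = refl
≡ᵇ-false (suc m) (suc n) m≢n = ≡ᵇ-false m n (m≢n ∘ cong suc)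

toℕ-punchIn-below : ∀ {n} (c : Fin (suc n)) (j : Fin n) → toℕ j < toℕ c → toℕ (punchIn c j) ≡ toℕ j
toℕ-punchIn-below (suc c) zero    _         = refl
toℕ-punchIn-below (suc c) (suc j) (s≤s j<c) = cong suc (toℕ-punchIn-below c j j<c)

toℕ-punchIn-above : ∀ {n} (c : Fin (suc n)) (j : Fin n) → toℕ c ≤ toℕ j → toℕ (punchIn c j) ≡ suc (toℕ j)
toℕ-punchIn-above zero    j       _         = refl
toℕ-punchIn-above (suc c) (suc j) (s≤s c≤j) = cong suc (toℕ-punchIn-above c j c≤j)

-- Expanding along the first row, each of the first k + 1 rows has a single 1 in the remaining
-- columns, on the anti-diagonal r + j = k.
det₂-antidiagonalBlock : ∀ k t (M : Matrix (suc k + t)) → (∀ r j → toℕ r ≤ k → M r j ≡ (toℕ r + toℕ j ≡ᵇ k)) →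
  det₂ (suc k + t) M ≡ det₂ t (λ i j → M (suc k ↑ʳ i) (suc k ↑ʳ j))
det₂-antidiagonalBlock zero t M top =
  trans (sum-single _ zero otherColumn) (cong (_∧ det₂ t (minor M zero)) (top zero zero z≤n))
  where
  otherColumn : ∀ c → c ≢ zero → M zero c ∧ det₂ t (minor M c) ≡ false
  otherColumn zero    c≢0 = ⊥-elim (c≢0 refl)
  otherColumn (suc c) _   = cong (_∧ det₂ t (minor M (suc c))) (top zero (suc c) z≤n)
det₂-antidiagonalBlock (suc k) t M top =
  trans (sum-single _ c₀ otherColumn)
   (trans (cong (_∧ det₂ (suc k + t) (minor M c₀)) (trans (top zero c₀ z≤n) (≡ᵇ-true _ _ toℕ-c₀)))
     (trans (det₂-antidiagonalBlock k t (minor M c₀) minorTop) (det₂-cong t lowerBlock)))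
  where
  c₀ : Fin (suc (suc k + t))
  c₀ = fromℕ< {suc k} (s≤s (s≤s (ℕₚ.m≤m+n k t)))
  toℕ-c₀ : toℕ c₀ ≡ suc k
  toℕ-c₀ = toℕ-fromℕ< (s≤s (s≤s (ℕₚ.m≤m+n k t)))
  otherColumn : ∀ c → c ≢ c₀ → M zero c ∧ det₂ (suc k + t) (minor M c) ≡ false
  otherColumn c c≢c₀ = cong (_∧ det₂ (suc k + t) (minor M c))
    (trans (top zero c z≤n) (≡ᵇ-false _ _ (λ eq → c≢c₀ (toℕ-injective (trans eq (sym toℕ-c₀))))))
  minorTop : ∀ r j → toℕ r ≤ k → minor M c₀ r j ≡ (toℕ r + toℕ j ≡ᵇ k)
  minorTop r j r≤k with toℕ j <? suc k
  ... | yes j<k = trans (top (suc r) (punchIn c₀ j) (s≤s r≤k))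
    (cong (λ z → suc (toℕ r) + z ≡ᵇ suc k) (toℕ-punchIn-below c₀ j (subst (toℕ j <_) (sym toℕ-c₀) j<k)))
  ... | no  j≮k = trans (top (suc r) (punchIn c₀ j) (s≤s r≤k))
    (trans (cong (λ z → suc (toℕ r) + z ≡ᵇ suc k) (toℕ-punchIn-above c₀ j (subst (_≤ toℕ j) (sym toℕ-c₀) k<j)))
      (trans (≡ᵇ-false (toℕ r + suc (toℕ j)) k (λ eq → ℕₚ.<-irrefl (sym eq)
                (ℕₚ.<-≤-trans (ℕₚ.≤-trans k<j (ℕₚ.n≤1+n (toℕ j))) (ℕₚ.m≤n+m (suc (toℕ j)) (toℕ r)))))
        (sym (≡ᵇ-false (toℕ r + toℕ j) k (λ eq → ℕₚ.<-irrefl (sym eq) (ℕₚ.<-≤-trans k<j (ℕₚ.m≤n+m (toℕ j) (toℕ r))))))))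
    where
    k<j : suc k ≤ toℕ j
    k<j = ℕₚ.≮⇒≥ j≮k
  lowerBlock : ∀ i j → minor M c₀ (suc k ↑ʳ i) (suc k ↑ʳ j) ≡ M (suc (suc k) ↑ʳ i) (suc (suc k) ↑ʳ j)
  lowerBlock i j = cong (M (suc (suc k ↑ʳ i))) (toℕ-injective
    (toℕ-punchIn-above c₀ (suc k ↑ʳ j)
      (subst (_≤ toℕ (suc k ↑ʳ j)) (sym toℕ-c₀) (subst (suc k ≤_) (sym (toℕ-↑ʳ (suc k) j)) (ℕₚ.m≤m+n (suc k) (toℕ j))))))

upperToeplitz : ∀ {n} → Series → Matrix n
upperToeplitz f i j = if does (toℕ i ≤? toℕ j) then f (toℕ j ∸ toℕ i) else false

sum-∧-upperToeplitz : ∀ {n} (x f : Series) (j : Fin n) →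
  sum (λ i → x (toℕ i) ∧ upperToeplitz f i j) ≡ conv x f (toℕ j)
sum-∧-upperToeplitz {n} x f j = begin
  sum {n} (λ i → term (toℕ i))               ≡⟨ sum≡Σ< n term ⟩
  Σ< n term                                  ≡⟨ cong (λ m → Σ< m term) (sym (ℕₚ.m+[n∸m]≡n (toℕ<n j))) ⟩
  Σ< (suc (toℕ j) + (n ∸ suc (toℕ j))) term  ≡⟨ Σ<-truncate (suc (toℕ j)) _ term beyond ⟩
  Σ< (suc (toℕ j)) term                      ≡⟨ Σ<-cong (suc (toℕ j)) within ⟩
  conv x f (toℕ j)                           ∎
  where
  open ≡-Reasoning
  term : Series
  term i = x i ∧ (if does (i ≤? toℕ j) then f (toℕ j ∸ i) else false)
  beyond : ∀ i → suc (toℕ j) ≤ i → term i ≡ false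
  beyond i j<i = trans (cong (λ b → x i ∧ (if b then f (toℕ j ∸ i) else false)) (dec-false (i ≤? toℕ j) (ℕₚ.<⇒≱ j<i)))
                       (∧-zeroʳ (x i))
  within : ∀ i → i < suc (toℕ j) → term i ≡ x i ∧ f (toℕ j ∸ i)
  within i (s≤s i≤j) = cong (λ b → x i ∧ (if b then f (toℕ j ∸ i) else false)) (dec-true (i ≤? toℕ j) i≤j)

-- Multiplying every row of a Hankel-like matrix by a power series with constant term 1
-- is right multiplication by a unitriangular Toeplitz matrix.
det₂-convRows : ∀ n (x : Fin n → Series) f → f 0 ≡ true →
  det₂ n (λ r j → conv (x r) f (toℕ j)) ≡ det₂ n (λ r j → x r (toℕ j))
det₂-convRows n x f f0≡true =
  trans (sym (det₂-cong n (λ r j → sum-∧-upperToeplitz (x r) f j)))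
        (det₂-mulUnitriangular n (λ r j → x r (toℕ j)) (upperToeplitz f) diagonal lower)
  where
  diagonal : ∀ j → upperToeplitz f j j ≡ true
  diagonal j = trans (cong (λ b → if b then f (toℕ j ∸ toℕ j) else false) (dec-true (toℕ j ≤? toℕ j) ℕₚ.≤-refl))
                     (trans (cong f (ℕₚ.n∸n≡0 (toℕ j))) f0≡true)
  lower : ∀ i j → toℕ j < toℕ i → upperToeplitz f i j ≡ false
  lower i j j<i = cong (λ b → if b then f (toℕ j ∸ toℕ i) else false) (dec-false (toℕ i ≤? toℕ j) (ℕₚ.<⇒≱ j<i))

-- Han's reduction for Hankel determinants, read over 𝔽₂: a = xᵏ / (1 + … + x^(k+2) g).
module HankelReduction (a g d : Series) (k : ℕ) (d-0 : d 0 ≡ true)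
                       (d-tail : ∀ m → d (suc (suc (k + m))) ≡ g m)
                       (d*a≡xᵏ : ∀ m → conv d a m ≡ (m ≡ᵇ k)) where

  private
    a-first : ∀ m → (∀ i → i < m → a i ≡ false) → a m ≡ (m ≡ᵇ k)
    a-first m earlier = trans (sym (trans (cong₂ _xor_ (cong (_∧ a m) d-0)
        (Σ<-false m _ (λ i i<m → trans (cong (d (suc i) ∧_) (earlier (m ∸ suc i) (ℕₚ.∸-monoʳ-< (s≤s z≤n) i<m)))
                                        (∧-zeroʳ _))))
      (xor-identityʳ (a m)))) (d*a≡xᵏ m)

    a-upTo : ∀ m → m ≤ k → ∀ i → i < m → a i ≡ false
    a-upTo (suc m) m<k i (s≤s i≤m) with i <? m
    ... | yes i<m = a-upTo m (ℕₚ.≤-trans (ℕₚ.n≤1+n m) m<k) i i<m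
    ... | no  i≮m with ℕₚ.≤-antisym i≤m (ℕₚ.≮⇒≥ i≮m)
    ...   | refl = trans (a-first i (a-upTo i (ℕₚ.≤-trans (ℕₚ.n≤1+n i) m<k))) (≡ᵇ-false i k (λ i≡k → ℕₚ.<-irrefl i≡k m<k))

    a-below : ∀ m → m < k → a m ≡ false
    a-below m m<k = a-upTo (suc m) m<k m ℕₚ.≤-refl

    a-k : a k ≡ true
    a-k = trans (a-first k (a-upTo k ℕₚ.≤-refl)) (≡ᵇ-true k k refl)

    reduced : ℕ → ℕ → Bool
    reduced R J = conv d (λ x → a (R + x)) J

    reduced-split : ∀ R J → conv d a (J + R) ≡ reduced R J xor Σ< R (λ l → d (suc J + l) ∧ a (R ∸ suc l))
    reduced-split R J = trans (Σ<-+ (suc J) R (λ i → d i ∧ a (J + R ∸ i)))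
      (cong₂ _xor_
        (Σ<-cong (suc J) (λ i i≤J → cong (λ z → d i ∧ a z)
          (trans (ℕₚ.+-∸-comm R (ℕₚ.≤-pred i≤J)) (ℕₚ.+-comm (J ∸ i) R))))
        (Σ<-cong R (λ l _ → cong (λ z → d (suc J + l) ∧ a z)
          (trans (cong (J + R ∸_) (sym (ℕₚ.+-suc J l))) (ℕₚ.[m+n]∸[m+o]≡n∸o J R (suc l))))))

    reduced-top : ∀ R J → R ≤ k → reduced R J ≡ (R + J ≡ᵇ k)
    reduced-top R J R≤k = begin
      reduced R J                                                   ≡⟨ sym (xor-identityʳ _) ⟩
      reduced R J xor false                                         ≡⟨ cong (reduced R J xor_) (sym (Σ<-false R _ vanish)) ⟩
      reduced R J xor Σ< R (λ l → d (suc J + l) ∧ a (R ∸ suc l))    ≡⟨ sym (reduced-split R J) ⟩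
      conv d a (J + R)                                              ≡⟨ d*a≡xᵏ (J + R) ⟩
      (J + R ≡ᵇ k)                                                  ≡⟨ cong (_≡ᵇ k) (ℕₚ.+-comm J R) ⟩
      (R + J ≡ᵇ k)                                                  ∎
      where
      open ≡-Reasoning
      vanish : ∀ l → l < R → d (suc J + l) ∧ a (R ∸ suc l) ≡ false
      vanish l l<R = trans (cong (d (suc J + l) ∧_)
        (a-below (R ∸ suc l) (ℕₚ.<-≤-trans (ℕₚ.∸-monoʳ-< (s≤s z≤n) l<R) R≤k))) (∧-zeroʳ _)

    reduced-block : ∀ y x → reduced (suc k + y) (suc k + x) ≡ conv (λ l → g (x + l)) (λ l → a (k + l)) y
    reduced-block y x = trans (xor-moveʳ (reduced R J) (Σ< R f) false reduced⊕tail≡0) tail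
      where
      R = suc k + y
      J = suc k + x
      f : Series
      f l = d (suc J + l) ∧ a (R ∸ suc l)
      reduced⊕tail≡0 : reduced R J xor Σ< R f ≡ false
      reduced⊕tail≡0 = trans (sym (reduced-split R J)) (trans (d*a≡xᵏ (J + R))
        (≡ᵇ-false (J + R) k (λ eq → ℕₚ.<-irrefl (sym eq)
          (ℕₚ.<-≤-trans (ℕₚ.n<1+n k) (ℕₚ.≤-trans (ℕₚ.m≤m+n (suc k) x) (ℕₚ.m≤m+n J R))))))
      f≡ : ∀ l → f l ≡ g (x + l) ∧ a (k + y ∸ l)
      f≡ l = cong (_∧ a (k + y ∸ l)) (trans (cong (λ z → d (suc (suc z))) (ℕₚ.+-assoc k x l)) (d-tail (x + l)))
      a-index : ∀ l → l < k → k + y ∸ (suc y + l) < k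
      a-index l l<k = subst (_< k)
        (sym (trans (cong₂ _∸_ (ℕₚ.+-comm k y) (sym (ℕₚ.+-suc y l))) (ℕₚ.[m+n]∸[m+o]≡n∸o y k (suc l))))
        (ℕₚ.∸-monoʳ-< (s≤s z≤n) l<k)
      tail : Σ< R f ≡ conv (λ l → g (x + l)) (λ l → a (k + l)) y
      tail = begin
        Σ< R f
          ≡⟨ cong (λ n → Σ< n f) (cong suc (ℕₚ.+-comm k y)) ⟩
        Σ< (suc y + k) f
          ≡⟨ Σ<-+ (suc y) k f ⟩
        Σ< (suc y) f xor Σ< k (λ l → f (suc y + l))
          ≡⟨ cong (Σ< (suc y) f xor_) (Σ<-false k _ (λ l l<k →
               trans (f≡ (suc y + l)) (trans (cong (g (x + (suc y + l)) ∧_) (a-below _ (a-index l l<k))) (∧-zeroʳ _)))) ⟩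
        Σ< (suc y) f xor false
          ≡⟨ xor-identityʳ _ ⟩
        Σ< (suc y) f
          ≡⟨ Σ<-cong (suc y) (λ l l<1+y → trans (f≡ l)
               (cong (λ z → g (x + l) ∧ a z) (ℕₚ.+-∸-assoc k (ℕₚ.≤-pred l<1+y)))) ⟩
        conv (λ l → g (x + l)) (λ l → a (k + l)) y ∎
        where open ≡-Reasoning

  hankel₂-vanish : ∀ n → n < k → hankel₂ a (suc n) ≡ false
  hankel₂-vanish n n<k = sum-false _ (λ j → cong (_∧ det₂ n (minor (λ i j → a (toℕ i + toℕ j)) j)) (a-below (toℕ j) (ℕₚ.<-≤-trans (toℕ<n j) n<k)))

  hankel₂-reduce : ∀ t → hankel₂ a (suc k + t) ≡ hankel₂ g t
  hankel₂-reduce t = begin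
    hankel₂ a (suc k + t)
      ≡⟨ sym (det₂-convRows (suc k + t) (λ r x → a (toℕ r + x)) d d-0) ⟩
    det₂ (suc k + t) (λ r j → conv (λ x → a (toℕ r + x)) d (toℕ j))
      ≡⟨ det₂-cong (suc k + t) (λ r j → conv-comm (toℕ j) (λ x → a (toℕ r + x)) d) ⟩
    det₂ (suc k + t) (λ r j → reduced (toℕ r) (toℕ j))
      ≡⟨ det₂-antidiagonalBlock k t _ (λ r j r≤k → reduced-top (toℕ r) (toℕ j) r≤k) ⟩
    det₂ t (λ i j → reduced (toℕ (suc k ↑ʳ i)) (toℕ (suc k ↑ʳ j)))
      ≡⟨ det₂-cong t (λ i j → trans (cong₂ reduced (toℕ-↑ʳ (suc k) i) (toℕ-↑ʳ (suc k) j))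
                                    (reduced-block (toℕ i) (toℕ j))) ⟩
    det₂ t (λ i j → conv (λ l → g (toℕ j + l)) (λ l → a (k + l)) (toℕ i))
      ≡⟨ det₂-transpose t (λ i j → conv (λ l → g (toℕ i + l)) (λ l → a (k + l)) (toℕ j)) ⟩
    det₂ t (λ i j → conv (λ l → g (toℕ i + l)) (λ l → a (k + l)) (toℕ j))
      ≡⟨ det₂-convRows t (λ i l → g (toℕ i + l)) (λ l → a (k + l)) (trans (cong a (ℕₚ.+-identityʳ k)) a-k) ⟩
    hankel₂ g t ∎
    where open ≡-Reasoning

module QuadraticSeries (T : Series) (A B : Poly)
                       (T-quadratic : conv ⟦ A ⟧ (conv T T) ≗ conv ⟦ B ⟧ T ⊕ ⟦ one ⟧) where

  linear : Poly → Poly → Series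
  linear P Q = conv ⟦ P ⟧ T ⊕ ⟦ Q ⟧

  quadratic : Poly → Poly → Poly → Series
  quadratic w u v = conv ⟦ w ⟧ (conv T T) ⊕ conv ⟦ u ⟧ T ⊕ ⟦ v ⟧

  private
    ⟦mulP⟧-assoc : ∀ p q (f : Series) → conv ⟦ mulP p q ⟧ f ≗ conv ⟦ p ⟧ (conv ⟦ q ⟧ f)
    ⟦mulP⟧-assoc p q f m = trans (conv-congˡ f (⟦mulP⟧ p q) m) (conv-assoc ⟦ p ⟧ ⟦ q ⟧ f m)

    ⟦addP⟧-distrib : ∀ p q (f : Series) → conv ⟦ addP p q ⟧ f ≗ conv ⟦ p ⟧ f ⊕ conv ⟦ q ⟧ f
    ⟦addP⟧-distrib p q f m = trans (conv-congˡ f (⟦addP⟧ p q) m) (conv-distribʳ-⊕ ⟦ p ⟧ ⟦ q ⟧ f m)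

  linear-cong : ∀ {P Q P′ Q′} → ⟦ P ⟧ ≗ ⟦ P′ ⟧ → ⟦ Q ⟧ ≗ ⟦ Q′ ⟧ → linear P Q ≗ linear P′ Q′
  linear-cong P≗P′ Q≗Q′ m = cong₂ _xor_ (conv-congˡ T P≗P′ m) (Q≗Q′ m)

  linear-⊕ : ∀ P Q P′ Q′ → linear P Q ⊕ linear P′ Q′ ≗ linear (addP P P′) (addP Q Q′)
  linear-⊕ P Q P′ Q′ m = trans (xor-interchange (conv ⟦ P ⟧ T m) (⟦ Q ⟧ m) (conv ⟦ P′ ⟧ T m) (⟦ Q′ ⟧ m))
    (sym (cong₂ _xor_ (⟦addP⟧-distrib P P′ T m) (⟦addP⟧ Q Q′ m)))

  conv-linear : ∀ c P Q → conv ⟦ c ⟧ (linear P Q) ≗ linear (mulP c P) (mulP c Q)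
  conv-linear c P Q m = trans (conv-distribˡ-⊕ ⟦ c ⟧ (conv ⟦ P ⟧ T) ⟦ Q ⟧ m)
    (sym (cong₂ _xor_ (⟦mulP⟧-assoc c P T m) (⟦mulP⟧ c Q m)))

  conv-linear-linear : ∀ P Q P′ Q′ →
    conv (linear P Q) (linear P′ Q′) ≗ quadratic (mulP P P′) (addP (mulP P Q′) (mulP Q P′)) (mulP Q Q′)
  conv-linear-linear P Q P′ Q′ m = begin
    conv (linear P Q) (linear P′ Q′) m
      ≡⟨ conv-distribʳ-⊕ (conv ⟦ P ⟧ T) ⟦ Q ⟧ (linear P′ Q′) m ⟩
    conv PT (linear P′ Q′) m xor conv ⟦ Q ⟧ (linear P′ Q′) m
      ≡⟨ cong₂ _xor_ (conv-distribˡ-⊕ PT P′T ⟦ Q′ ⟧ m) (conv-distribˡ-⊕ ⟦ Q ⟧ P′T ⟦ Q′ ⟧ m) ⟩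
    (conv PT P′T m xor conv PT ⟦ Q′ ⟧ m) xor (conv ⟦ Q ⟧ P′T m xor conv ⟦ Q ⟧ ⟦ Q′ ⟧ m)
      ≡⟨ sym (xor-assoc (conv PT P′T m xor conv PT ⟦ Q′ ⟧ m) (conv ⟦ Q ⟧ P′T m) (conv ⟦ Q ⟧ ⟦ Q′ ⟧ m)) ⟩
    ((conv PT P′T m xor conv PT ⟦ Q′ ⟧ m) xor conv ⟦ Q ⟧ P′T m) xor conv ⟦ Q ⟧ ⟦ Q′ ⟧ m
      ≡⟨ cong (_xor conv ⟦ Q ⟧ ⟦ Q′ ⟧ m) (xor-assoc (conv PT P′T m) (conv PT ⟦ Q′ ⟧ m) (conv ⟦ Q ⟧ P′T m)) ⟩
    (conv PT P′T m xor (conv PT ⟦ Q′ ⟧ m xor conv ⟦ Q ⟧ P′T m)) xor conv ⟦ Q ⟧ ⟦ Q′ ⟧ m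
      ≡⟨ sym (cong₂ _xor_ (cong₂ _xor_ square (trans (⟦addP⟧-distrib (mulP P Q′) (mulP Q P′) T m) (cong₂ _xor_ cross₁ cross₂)))
                          (⟦mulP⟧ Q Q′ m)) ⟩
    quadratic (mulP P P′) (addP (mulP P Q′) (mulP Q P′)) (mulP Q Q′) m ∎
    where
    open ≡-Reasoning
    PT = conv ⟦ P ⟧ T
    P′T = conv ⟦ P′ ⟧ T
    square : conv ⟦ mulP P P′ ⟧ (conv T T) m ≡ conv PT P′T m
    square = trans (⟦mulP⟧-assoc P P′ (conv T T) m)
      (trans (conv-congʳ ⟦ P ⟧ (conv-lcomm ⟦ P′ ⟧ T T) m) (sym (conv-assoc ⟦ P ⟧ T P′T m)))
    cross₁ : conv ⟦ mulP P Q′ ⟧ T m ≡ conv PT ⟦ Q′ ⟧ m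
    cross₁ = trans (⟦mulP⟧-assoc P Q′ T m)
      (trans (conv-congʳ ⟦ P ⟧ (λ i → conv-comm i ⟦ Q′ ⟧ T) m) (sym (conv-assoc ⟦ P ⟧ T ⟦ Q′ ⟧ m)))
    cross₂ : conv ⟦ mulP Q P′ ⟧ T m ≡ conv ⟦ Q ⟧ P′T m
    cross₂ = ⟦mulP⟧-assoc Q P′ T m

  conv-A-quadratic : ∀ w u v →
    conv ⟦ A ⟧ (quadratic w u v) ≗ linear (addP (mulP w B) (mulP A u)) (addP w (mulP A v))
  conv-A-quadratic w u v m = begin
    conv ⟦ A ⟧ (quadratic w u v) m
      ≡⟨ conv-distribˡ-⊕ ⟦ A ⟧ (conv ⟦ w ⟧ (conv T T) ⊕ conv ⟦ u ⟧ T) ⟦ v ⟧ m ⟩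
    conv ⟦ A ⟧ (conv ⟦ w ⟧ (conv T T) ⊕ conv ⟦ u ⟧ T) m xor conv ⟦ A ⟧ ⟦ v ⟧ m
      ≡⟨ cong₂ _xor_ (conv-distribˡ-⊕ ⟦ A ⟧ (conv ⟦ w ⟧ (conv T T)) (conv ⟦ u ⟧ T) m) (sym (⟦mulP⟧ A v m)) ⟩
    (conv ⟦ A ⟧ (conv ⟦ w ⟧ (conv T T)) m xor conv ⟦ A ⟧ (conv ⟦ u ⟧ T) m) xor ⟦ mulP A v ⟧ m
      ≡⟨ cong₂ (λ x y → (x xor y) xor ⟦ mulP A v ⟧ m) reduceSquare (sym (⟦mulP⟧-assoc A u T m)) ⟩
    ((conv ⟦ mulP w B ⟧ T m xor ⟦ w ⟧ m) xor conv ⟦ mulP A u ⟧ T m) xor ⟦ mulP A v ⟧ m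
      ≡⟨ xor-assoc (conv ⟦ mulP w B ⟧ T m xor ⟦ w ⟧ m) (conv ⟦ mulP A u ⟧ T m) (⟦ mulP A v ⟧ m) ⟩
    (conv ⟦ mulP w B ⟧ T m xor ⟦ w ⟧ m) xor (conv ⟦ mulP A u ⟧ T m xor ⟦ mulP A v ⟧ m)
      ≡⟨ xor-interchange (conv ⟦ mulP w B ⟧ T m) (⟦ w ⟧ m) (conv ⟦ mulP A u ⟧ T m) (⟦ mulP A v ⟧ m) ⟩
    (conv ⟦ mulP w B ⟧ T m xor conv ⟦ mulP A u ⟧ T m) xor (⟦ w ⟧ m xor ⟦ mulP A v ⟧ m)
      ≡⟨ sym (cong₂ _xor_ (⟦addP⟧-distrib (mulP w B) (mulP A u) T m) (⟦addP⟧ w (mulP A v) m)) ⟩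
    linear (addP (mulP w B) (mulP A u)) (addP w (mulP A v)) m ∎
    where
    open ≡-Reasoning
    reduceSquare : conv ⟦ A ⟧ (conv ⟦ w ⟧ (conv T T)) m ≡ conv ⟦ mulP w B ⟧ T m xor ⟦ w ⟧ m
    reduceSquare = trans (conv-lcomm ⟦ A ⟧ ⟦ w ⟧ (conv T T) m)
      (trans (conv-congʳ ⟦ w ⟧ T-quadratic m)
        (trans (conv-distribˡ-⊕ ⟦ w ⟧ (conv ⟦ B ⟧ T) ⟦ one ⟧ m)
          (cong₂ _xor_ (sym (⟦mulP⟧-assoc w B T m)) (conv-identityʳ ⟦ w ⟧ m))))

  -- With L = P T + Q and L′ = P′ T + Q′, these are the coefficients of T and of 1 in
  -- A N′ (D L + E L′ L) after eliminating T² by the quadratic equation.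
  stepCoeffT : (N′ D P Q P′ Q′ E : Poly) → Poly
  stepCoeffT N′ D P Q P′ Q′ E =
    addP (mulP A (mulP (mulP N′ D) P)) (mulP E (addP (mulP (mulP P′ P) B) (mulP A (addP (mulP P′ Q) (mulP Q′ P)))))

  stepCoeff1 : (N′ D P Q P′ Q′ E : Poly) → Poly
  stepCoeff1 N′ D P Q P′ Q′ E =
    addP (mulP A (mulP (mulP N′ D) Q)) (mulP E (addP (mulP P′ P) (mulP A (mulP Q′ Q))))

  -- G = xᵏ / (D + E G′) for G = L / N and G′ = L′ / N′, reduced to identities between polynomials.
  module HFractionStep (N P Q N′ P′ Q′ D E : Poly) (G G′ : Series)
                       (NG≡L : conv ⟦ N ⟧ G ≗ linear P Q) (N′G′≡L′ : conv ⟦ N′ ⟧ G′ ≗ linear P′ Q′) (k : ℕ)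
                       (W-nonzero : isZero (mulP A (mulP N N′)) ≡ false)
                       (coeffT≡0 : isZero (stepCoeffT N′ D P Q P′ Q′ E) ≡ true)
                       (coeff1≡Wxᵏ : isZero (addP (stepCoeff1 N′ D P Q P′ Q′ E) (mulP (mulP A (mulP N N′)) (xPow k))) ≡ true)
                       where

    d : Series
    d = ⟦ D ⟧ ⊕ conv ⟦ E ⟧ G′

    private
      W = mulP A (mulP N N′)
      L = linear P Q
      N′D = mulP N′ D
      w = mulP P′ P
      u = addP (mulP P′ Q) (mulP Q′ P)
      v = mulP Q′ Q

      conv-W : ∀ X m → conv ⟦ W ⟧ X m ≡ conv ⟦ A ⟧ (conv ⟦ N′ ⟧ (conv ⟦ N ⟧ X)) m
      conv-W X m = trans (⟦mulP⟧-assoc A (mulP N N′) X m)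
        (conv-congʳ ⟦ A ⟧ (λ i → trans (⟦mulP⟧-assoc N N′ X i) (conv-lcomm ⟦ N ⟧ ⟦ N′ ⟧ X i)) m)

      conv-N′-dL : ∀ m → conv ⟦ N′ ⟧ (conv d L) m ≡ linear (mulP N′D P) (mulP N′D Q) m xor conv ⟦ E ⟧ (quadratic w u v) m
      conv-N′-dL m = begin
        conv ⟦ N′ ⟧ (conv d L) m
          ≡⟨ conv-congʳ ⟦ N′ ⟧ (conv-distribʳ-⊕ ⟦ D ⟧ (conv ⟦ E ⟧ G′) L) m ⟩
        conv ⟦ N′ ⟧ (conv ⟦ D ⟧ L ⊕ conv (conv ⟦ E ⟧ G′) L) m
          ≡⟨ conv-distribˡ-⊕ ⟦ N′ ⟧ (conv ⟦ D ⟧ L) (conv (conv ⟦ E ⟧ G′) L) m ⟩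
        conv ⟦ N′ ⟧ (conv ⟦ D ⟧ L) m xor conv ⟦ N′ ⟧ (conv (conv ⟦ E ⟧ G′) L) m
          ≡⟨ cong₂ _xor_ (trans (sym (⟦mulP⟧-assoc N′ D L m)) (conv-linear N′D P Q m)) EG′L ⟩
        linear (mulP N′D P) (mulP N′D Q) m xor conv ⟦ E ⟧ (quadratic w u v) m ∎
        where
        open ≡-Reasoning
        EG′L : conv ⟦ N′ ⟧ (conv (conv ⟦ E ⟧ G′) L) m ≡ conv ⟦ E ⟧ (quadratic w u v) m
        EG′L = trans (conv-congʳ ⟦ N′ ⟧ (conv-assoc ⟦ E ⟧ G′ L) m)
          (trans (conv-lcomm ⟦ N′ ⟧ ⟦ E ⟧ (conv G′ L) m)
            (conv-congʳ ⟦ E ⟧ (λ i → trans (sym (conv-assoc ⟦ N′ ⟧ G′ L i))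
                                      (trans (conv-congˡ L N′G′≡L′ i) (conv-linear-linear P′ Q′ P Q i))) m))

      W-dG≡W-xᵏ : conv ⟦ W ⟧ (conv d G) ≗ conv ⟦ W ⟧ ⟦ xPow k ⟧
      W-dG≡W-xᵏ m = begin
        conv ⟦ W ⟧ (conv d G) m
          ≡⟨ conv-W (conv d G) m ⟩
        conv ⟦ A ⟧ (conv ⟦ N′ ⟧ (conv ⟦ N ⟧ (conv d G))) m
          ≡⟨ conv-congʳ ⟦ A ⟧ (conv-congʳ ⟦ N′ ⟧ (λ i → trans (conv-lcomm ⟦ N ⟧ d G i) (conv-congʳ d NG≡L i))) m ⟩
        conv ⟦ A ⟧ (conv ⟦ N′ ⟧ (conv d L)) m
          ≡⟨ conv-congʳ ⟦ A ⟧ conv-N′-dL m ⟩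
        conv ⟦ A ⟧ (linear (mulP N′D P) (mulP N′D Q) ⊕ conv ⟦ E ⟧ (quadratic w u v)) m
          ≡⟨ conv-distribˡ-⊕ ⟦ A ⟧ (linear (mulP N′D P) (mulP N′D Q)) (conv ⟦ E ⟧ (quadratic w u v)) m ⟩
        conv ⟦ A ⟧ (linear (mulP N′D P) (mulP N′D Q)) m xor conv ⟦ A ⟧ (conv ⟦ E ⟧ (quadratic w u v)) m
          ≡⟨ cong₂ _xor_ (conv-linear A (mulP N′D P) (mulP N′D Q) m)
               (trans (conv-lcomm ⟦ A ⟧ ⟦ E ⟧ (quadratic w u v) m)
                 (trans (conv-congʳ ⟦ E ⟧ (conv-A-quadratic w u v) m)
                   (conv-linear E (addP (mulP w B) (mulP A u)) (addP w (mulP A v)) m))) ⟩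
        (linear (mulP A (mulP N′D P)) (mulP A (mulP N′D Q))
          ⊕ linear (mulP E (addP (mulP w B) (mulP A u))) (mulP E (addP w (mulP A v)))) m
          ≡⟨ linear-⊕ (mulP A (mulP N′D P)) (mulP A (mulP N′D Q)) _ _ m ⟩
        linear (stepCoeffT N′ D P Q P′ Q′ E) (stepCoeff1 N′ D P Q P′ Q′ E) m
          ≡⟨ linear-cong {stepCoeffT N′ D P Q P′ Q′ E} {stepCoeff1 N′ D P Q P′ Q′ E} {[]} {mulP W (xPow k)}
               (isZero-sound (stepCoeffT N′ D P Q P′ Q′ E) coeffT≡0)
               (isZero-addP-sound (stepCoeff1 N′ D P Q P′ Q′ E) (mulP W (xPow k)) coeff1≡Wxᵏ) m ⟩
        linear [] (mulP W (xPow k)) m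
          ≡⟨ cong (_xor ⟦ mulP W (xPow k) ⟧ m) (conv-zeroˡ T m) ⟩
        ⟦ mulP W (xPow k) ⟧ m
          ≡⟨ ⟦mulP⟧ W (xPow k) m ⟩
        conv ⟦ W ⟧ ⟦ xPow k ⟧ m ∎
        where open ≡-Reasoning

    d*G≡xᵏ : ∀ m → conv d G m ≡ (m ≡ᵇ k)
    d*G≡xᵏ m = trans (conv-cancelˡ W W-nonzero (conv d G) ⟦ xPow k ⟧ W-dG≡W-xᵏ m) (⟦xPow⟧ k m)

-- Profiles of a deterministic automaton on S whose state s emits 1, then k s zeros, and then
-- moves to next s; for an H-fraction these are exactly the Hankel determinants mod 2.
module AutomatonProfile {S : Set} (k : S → ℕ) (next : S → S) where

  record IsProfile (V : S → ℕ → Bool) : Set where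
    field
      at-0      : ∀ s → V s 0 ≡ true
      gap       : ∀ s i → i < k s → V s (suc i) ≡ false
      after-gap : ∀ s t → V s (suc (k s) + t) ≡ V (next s) t
  open IsProfile

  profile-unique : ∀ {V W} → IsProfile V → IsProfile W → ∀ s n → V s n ≡ W s n
  profile-unique {V} {W} isV isW s n = bounded (suc n) s n ℕₚ.≤-refl
    where
    bounded : ∀ b s n → n < b → V s n ≡ W s n
    bounded (suc b) s zero    _         = trans (at-0 isV s) (sym (at-0 isW s))
    bounded (suc b) s (suc n) (s≤s n<b) with n <? k s
    ... | yes n<k = trans (gap isV s n n<k) (sym (gap isW s n n<k))
    ... | no  n≮k = begin
      V s (suc n)                  ≡⟨ cong (V s) (sym split) ⟩
      V s (suc (k s) + t)          ≡⟨ after-gap isV s t ⟩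
      V (next s) t                 ≡⟨ bounded b (next s) t (ℕₚ.≤-<-trans (ℕₚ.m∸n≤m n (k s)) n<b) ⟩
      W (next s) t                 ≡⟨ sym (after-gap isW s t) ⟩
      W s (suc (k s) + t)          ≡⟨ cong (W s) split ⟩
      W s (suc n)                  ∎
      where
      open ≡-Reasoning
      t = n ∸ k s
      split : suc (k s) + t ≡ suc n
      split = cong suc (ℕₚ.m+[n∸m]≡n (ℕₚ.≮⇒≥ n≮k))

  unfold : ℕ → S → ℕ → Bool
  unfold zero    s n       = false
  unfold (suc f) s zero    = true
  unfold (suc f) s (suc n) = if does (n <? k s) then false else unfold f (next s) (n ∸ k s)

  periodic-isProfile : ∀ f p → (∀ s → k s < suc p) →
    (∀ s (r : Fin (suc p)) → unfold (suc f) s ((suc (k s) + toℕ r) % suc p) ≡ unfold (suc f) (next s) (toℕ r)) →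
    IsProfile (λ s n → unfold (suc f) s (n % suc p))
  periodic-isProfile f p k<p pat-shift = record
    { at-0      = λ s → refl
    ; gap       = λ s i i<k → trans (cong (pat s) (m<n⇒m%n≡m (ℕₚ.<-≤-trans (s≤s i<k) (k<p s))))
                    (cong (if_then false else unfold f (next s) (i ∸ k s)) (dec-true (i <? k s) i<k))
    ; after-gap = after-gap′
    }
    where
    pat = unfold (suc f)
    after-gap′ : ∀ s t → pat s ((suc (k s) + t) % suc p) ≡ pat (next s) (t % suc p)
    after-gap′ s t = begin
      pat s ((suc (k s) + t) % suc p)             ≡⟨ cong (pat s) (sym mod-inner) ⟩
      pat s ((suc (k s) + toℕ r) % suc p)         ≡⟨ pat-shift s r ⟩
      pat (next s) (toℕ r)                        ≡⟨ cong (pat (next s)) (toℕ-fromℕ< (m%n<n t (suc p))) ⟩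
      pat (next s) (t % suc p)                    ∎
      where
      open ≡-Reasoning
      r = fromℕ< (m%n<n t (suc p))
      mod-inner : (suc (k s) + toℕ r) % suc p ≡ (suc (k s) + t) % suc p
      mod-inner = begin
        (suc (k s) + toℕ r) % suc p                      ≡⟨ cong (λ z → (suc (k s) + z) % suc p) (toℕ-fromℕ< (m%n<n t (suc p))) ⟩
        (suc (k s) + t % suc p) % suc p                  ≡⟨ %-distribˡ-+ (suc (k s)) (t % suc p) (suc p) ⟩
        (suc (k s) % suc p + t % suc p % suc p) % suc p  ≡⟨ cong (λ z → (suc (k s) % suc p + z) % suc p) (m%n%n≡m%n t (suc p)) ⟩
        (suc (k s) % suc p + t % suc p) % suc p          ≡⟨ sym (%-distribˡ-+ (suc (k s)) t (suc p)) ⟩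
        (suc (k s) + t) % suc p                          ∎

odd : ℕ → Bool
odd zero          = false
odd (suc zero)    = true
odd (suc (suc n)) = odd n

bit : Bool → ℕ
bit false = 0
bit true  = 1

parity : ℤ → Bool
parity z = odd ℤ.∣ z ∣

odd-suc : ∀ n → odd (suc n) ≡ not (odd n)
odd-suc zero          = refl
odd-suc (suc zero)    = refl
odd-suc (suc (suc n)) = odd-suc n

odd-+ : ∀ m n → odd (m + n) ≡ odd m xor odd n
odd-+ zero          n = refl
odd-+ (suc zero)    n = odd-suc n
odd-+ (suc (suc m)) n = odd-+ m n

odd-* : ∀ m n → odd (m * n) ≡ odd m ∧ odd n
odd-* zero    n = refl
odd-* (suc m) n = begin
  odd (n + m * n)           ≡⟨ odd-+ n (m * n) ⟩
  odd n xor odd (m * n)     ≡⟨ cong (odd n xor_) (odd-* m n) ⟩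
  odd n xor odd m ∧ odd n   ≡⟨ absorb (odd m) (odd n) ⟩
  not (odd m) ∧ odd n       ≡⟨ cong (_∧ odd n) (sym (odd-suc m)) ⟩
  odd (suc m) ∧ odd n       ∎
  where
  open ≡-Reasoning
  absorb : ∀ a b → b xor a ∧ b ≡ not a ∧ b
  absorb false b = xor-identityʳ b
  absorb true  b = xor-same b

odd-suc-xor : ∀ m n → odd (suc m) xor odd (suc n) ≡ odd m xor odd n
odd-suc-xor m n = trans (cong₂ _xor_ (odd-suc m) (odd-suc n)) (xor-annihilates-not (odd m) (odd n))

odd-⊖ : ∀ m n → odd ℤ.∣ m ℤ.⊖ n ∣ ≡ odd m xor odd n
odd-⊖ m       zero    = sym (xor-identityʳ (odd m))
odd-⊖ zero    (suc n) = refl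
odd-⊖ (suc m) (suc n) = trans (cong (odd ∘ ℤ.∣_∣) (ℤₚ.[1+m]⊖[1+n]≡m⊖n m n))
                              (trans (odd-⊖ m n) (sym (odd-suc-xor m n)))

parity-+ : ∀ x y → parity (x ℤ.+ y) ≡ parity x xor parity y
parity-+ (+ m)      (+ n)      = odd-+ m n
parity-+ (+ m)      ℤ.-[1+ n ] = odd-⊖ m (suc n)
parity-+ ℤ.-[1+ m ] (+ n)      = trans (odd-⊖ n (suc m)) (xor-comm (odd n) (odd (suc m)))
parity-+ ℤ.-[1+ m ] ℤ.-[1+ n ] = trans (odd-+ m n) (sym (odd-suc-xor m n))

parity-* : ∀ x y → parity (x ℤ.* y) ≡ parity x ∧ parity y
parity-* x y = trans (cong odd (ℤₚ.abs-* x y)) (odd-* ℤ.∣ x ∣ ℤ.∣ y ∣)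

parity-neg : ∀ x → parity (ℤ.- x) ≡ parity x
parity-neg x = cong odd (ℤₚ.∣-i∣≡∣i∣ x)

parity-sign : ∀ k → parity (sign k) ≡ true
parity-sign zero    = refl
parity-sign (suc k) = trans (parity-neg (sign k)) (parity-sign k)

parity-Σᶠ : ∀ n (f : Fin n → ℤ) → parity (Σᶠ n f) ≡ sum (parity ∘ f)
parity-Σᶠ zero    f = refl
parity-Σᶠ (suc n) f = trans (parity-+ (f zero) (Σᶠ n (f ∘ suc))) (cong (parity (f zero) xor_) (parity-Σᶠ n (f ∘ suc)))

parity-det : ∀ n (M : Fin n → Fin n → ℤ) → parity (det n M) ≡ det₂ n (λ i j → parity (M i j))
parity-det zero    M = refl
parity-det (suc n) M = trans (parity-Σᶠ (suc n) term) (sum-cong-≗ termParity)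
  where
  minorℤ : Fin (suc n) → Fin n → Fin n → ℤ
  minorℤ j i k = M (suc i) (punchIn j k)
  term : Fin (suc n) → ℤ
  term j = sign (toℕ j) ℤ.* (M zero j ℤ.* det n (minorℤ j))
  termParity : ∀ j → parity (term j) ≡ parity (M zero j) ∧ det₂ n (λ i k → parity (minorℤ j i k))
  termParity j = trans (parity-* (sign (toℕ j)) (M zero j ℤ.* det n (minorℤ j)))
    (cong₂ _∧_ (parity-sign (toℕ j))
      (trans (parity-* (M zero j) (det n (minorℤ j))) (cong (parity (M zero j) ∧_) (parity-det n (minorℤ j)))))

%2≡bit-odd : ∀ n → n % 2 ≡ bit (odd n)
%2≡bit-odd zero          = refl
%2≡bit-odd (suc zero)    = refl
%2≡bit-odd (suc (suc n)) = trans (cong (_% 2) (ℕₚ.+-comm 2 n)) (trans ([m+kn]%n≡m%n n 1 2) (%2≡bit-odd n))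

%ℕ2≡bit-parity : ∀ z → z %ℕ 2 ≡ bit (parity z)
%ℕ2≡bit-parity (+ n)      = %2≡bit-odd n
%ℕ2≡bit-parity ℤ.-[1+ n ] rewrite %2≡bit-odd (suc n) with odd (suc n)
... | false = refl
... | true  = refl

H%2≡hankel₂ : ∀ (a : ℕ → ℤ) n → H a n %ℕ 2 ≡ bit (hankel₂ (parity ∘ a) n)
H%2≡hankel₂ a n = trans (%ℕ2≡bit-parity (H a n)) (cong bit (parity-det n (λ i j → a (toℕ i + toℕ j))))

odd-double : ∀ n → odd (n + n) ≡ false
odd-double n = trans (odd-+ n n) (xor-same (odd n))

odd-double+1 : ∀ n → odd (suc (n + n)) ≡ true
odd-double+1 n = trans (odd-suc (n + n)) (cong not (odd-double n))

-- The Rudin–Shapiro sequence mod 2: the parity of the number of (possibly overlapping)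
-- blocks 11 in the binary expansion of n.  Any fuel larger than n gives the same value.
rsFuel : ℕ → ℕ → Bool
rsFuel zero    n = false
rsFuel (suc f) n = (odd n ∧ odd ⌊ n /2⌋) xor rsFuel f ⌊ n /2⌋

rs : ℕ → Bool
rs n = rsFuel (suc n) n

rsFuel-0 : ∀ f → rsFuel f 0 ≡ false
rsFuel-0 zero    = refl
rsFuel-0 (suc f) = rsFuel-0 f

rsFuel-irrelevant : ∀ f f′ n → n < f → n < f′ → rsFuel f n ≡ rsFuel f′ n
rsFuel-irrelevant (suc f) (suc f′) zero    _         _          = trans (rsFuel-0 f) (sym (rsFuel-0 f′))
rsFuel-irrelevant (suc f) (suc f′) (suc n) (s≤s n<f) (s≤s n<f′) =
  cong ((odd (suc n) ∧ odd ⌊ suc n /2⌋) xor_)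
    (rsFuel-irrelevant f f′ ⌊ suc n /2⌋ (ℕₚ.<-≤-trans (ℕₚ.⌊n/2⌋<n n) n<f) (ℕₚ.<-≤-trans (ℕₚ.⌊n/2⌋<n n) n<f′))

rs-unfold : ∀ n → rs n ≡ (odd n ∧ odd ⌊ n /2⌋) xor rs ⌊ n /2⌋
rs-unfold zero    = refl
rs-unfold (suc n) = cong ((odd (suc n) ∧ odd ⌊ suc n /2⌋) xor_)
  (rsFuel-irrelevant (suc n) (suc ⌊ suc n /2⌋) ⌊ suc n /2⌋ (ℕₚ.⌊n/2⌋<n n) ℕₚ.≤-refl)

rs-double : ∀ n → rs (n + n) ≡ rs n
rs-double n = trans (rs-unfold (n + n))
  (cong₂ (λ b m → (b ∧ odd m) xor rs m) (odd-double n) (sym (ℕₚ.n≡⌊n+n/2⌋ n)))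

rs-double+1 : ∀ n → rs (suc (n + n)) ≡ odd n xor rs n
rs-double+1 n = trans (rs-unfold (suc (n + n)))
  (cong₂ (λ b m → (b ∧ odd m) xor rs m) (odd-double+1 n) (sym (ℕₚ.n≡⌈n+n/2⌉ n)))

rs-4n+1 : ∀ n → rs (suc ((n + n) + (n + n))) ≡ rs n
rs-4n+1 n = trans (rs-double+1 (n + n)) (cong₂ _xor_ (odd-double n) (rs-double n))

rs-4n+3 : ∀ n → rs (3 + ((n + n) + (n + n))) ≡ not (rs (suc (n + n)))
rs-4n+3 n = begin
  rs (3 + ((n + n) + (n + n)))            ≡⟨ cong rs (4n+3≡2[2n+1]+1 n) ⟩
  rs (suc (suc (n + n) + suc (n + n)))    ≡⟨ rs-double+1 (suc (n + n)) ⟩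
  odd (suc (n + n)) xor rs (suc (n + n))  ≡⟨ cong (_xor rs (suc (n + n))) (odd-double+1 n) ⟩
  not (rs (suc (n + n)))                  ∎
  where
  open ≡-Reasoning
  4n+3≡2[2n+1]+1 : ∀ n → 3 + ((n + n) + (n + n)) ≡ suc (suc (n + n) + suc (n + n))
  4n+3≡2[2n+1]+1 = solve-∀

frobenius : Series → Series
frobenius f zero          = f 0
frobenius f (suc zero)    = false
frobenius f (suc (suc m)) = frobenius (f ∘ suc) m

conv-self≡frobenius : ∀ m f → conv f f m ≡ frobenius f m
conv-self≡frobenius zero          f = trans (xor-identityʳ _) (∧-idem (f 0))
  where
  ∧-idem : ∀ b → b ∧ b ≡ b
  ∧-idem false = refl
  ∧-idem true  = refl
conv-self≡frobenius (suc zero)    f =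
  trans (cong ((f 0 ∧ f 1) xor_) (trans (xor-identityʳ _) (∧-comm (f 1) (f 0)))) (xor-same (f 0 ∧ f 1))
conv-self≡frobenius (suc (suc m)) f = begin
  (f 0 ∧ f (2 + m)) xor conv (f ∘ suc) f (suc m)
    ≡⟨ cong ((f 0 ∧ f (2 + m)) xor_) (conv-comm (suc m) (f ∘ suc) f) ⟩
  (f 0 ∧ f (2 + m)) xor ((f 0 ∧ f (2 + m)) xor conv (f ∘ suc) (f ∘ suc) m)
    ≡⟨ sym (xor-assoc (f 0 ∧ f (2 + m)) _ _) ⟩
  ((f 0 ∧ f (2 + m)) xor (f 0 ∧ f (2 + m))) xor conv (f ∘ suc) (f ∘ suc) m
    ≡⟨ cong (_xor conv (f ∘ suc) (f ∘ suc) m) (xor-same (f 0 ∧ f (2 + m))) ⟩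
  conv (f ∘ suc) (f ∘ suc) m
    ≡⟨ conv-self≡frobenius m (f ∘ suc) ⟩
  frobenius (f ∘ suc) m ∎
  where open ≡-Reasoning

frobenius-even : ∀ p f → frobenius f (p + p) ≡ f p
frobenius-even zero    f = refl
frobenius-even (suc p) f = trans (cong (frobenius f) (cong suc (ℕₚ.+-suc p p))) (frobenius-even p (f ∘ suc))

frobenius-odd : ∀ p f → frobenius f (suc (p + p)) ≡ false
frobenius-odd zero    f = refl
frobenius-odd (suc p) f = trans (cong (λ n → frobenius f (suc (suc n))) (ℕₚ.+-suc p p)) (frobenius-odd p (f ∘ suc))

data EvenOrOdd : ℕ → Set where
  is-even : ∀ p → EvenOrOdd (p + p)
  is-odd  : ∀ p → EvenOrOdd (suc (p + p))

evenOrOdd : ∀ n → EvenOrOdd n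
evenOrOdd zero = is-even 0
evenOrOdd (suc n) with evenOrOdd n
... | is-even p = is-odd p
... | is-odd  p = subst EvenOrOdd (cong suc (ℕₚ.+-suc p p)) (is-even (suc p))

T : Series
T i = rs (3 + i)

quadA : Poly
quadA = false ∷ false ∷ false ∷ true ∷ true ∷ false ∷ false ∷ true ∷ true ∷ []

quadB : Poly
quadB = true ∷ false ∷ false ∷ false ∷ true ∷ []

conv-quadA : ∀ (F : Series) m → conv ⟦ quadA ⟧ F (8 + m) ≡ F (5 + m) xor (F (4 + m) xor (F (1 + m) xor F m))
conv-quadA F m = cong (λ z → F (5 + m) xor (F (4 + m) xor (F (1 + m) xor z))) (conv-identityˡ F m)

conv-quadB : ∀ (F : Series) m → conv ⟦ quadB ⟧ F (4 + m) ≡ F (4 + m) xor F m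
conv-quadB F m = cong (F (4 + m) xor_) (conv-identityˡ F m)

T-even-coefficient : ∀ p → rs (5 + p) xor rs (3 + p) ≡ rs (11 + (p + p)) xor rs (7 + (p + p))
T-even-coefficient p with evenOrOdd p
... | is-even q = sym (begin
  rs (11 + ((q + q) + (q + q))) xor rs (7 + ((q + q) + (q + q)))
    ≡⟨ cong₂ _xor_ (cong rs (11+4q≡3+4[2+q] q)) (cong rs (7+4q≡3+4[1+q] q)) ⟩
  rs (3 + (2 + q + (2 + q)) + (2 + q + (2 + q))) xor rs (3 + (1 + q + (1 + q)) + (1 + q + (1 + q)))
    ≡⟨ cong₂ _xor_ (rs-4n+3 (2 + q)) (rs-4n+3 (1 + q)) ⟩
  not (rs (suc (2 + q + (2 + q)))) xor not (rs (suc (1 + q + (1 + q))))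
    ≡⟨ xor-annihilates-not (rs (suc (2 + q + (2 + q)))) (rs (suc (1 + q + (1 + q)))) ⟩
  rs (suc (2 + q + (2 + q))) xor rs (suc (1 + q + (1 + q)))
    ≡⟨ cong₂ _xor_ (cong rs (sym (5+2q≡1+2[2+q] q))) (cong rs (sym (3+2q≡1+2[1+q] q))) ⟩
  rs (5 + (q + q)) xor rs (3 + (q + q)) ∎)
  where
  open ≡-Reasoning
  11+4q≡3+4[2+q] : ∀ q → 11 + ((q + q) + (q + q)) ≡ 3 + (2 + q + (2 + q)) + (2 + q + (2 + q))
  11+4q≡3+4[2+q] = solve-∀
  7+4q≡3+4[1+q] : ∀ q → 7 + ((q + q) + (q + q)) ≡ 3 + (1 + q + (1 + q)) + (1 + q + (1 + q))
  7+4q≡3+4[1+q] = solve-∀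
  5+2q≡1+2[2+q] : ∀ q → 5 + (q + q) ≡ suc (2 + q + (2 + q))
  5+2q≡1+2[2+q] = solve-∀
  3+2q≡1+2[1+q] : ∀ q → 3 + (q + q) ≡ suc (1 + q + (1 + q))
  3+2q≡1+2[1+q] = solve-∀
... | is-odd q = begin
  rs (5 + suc (q + q)) xor rs (3 + suc (q + q))
    ≡⟨ cong₂ _xor_ (trans (cong rs (6+2q≡2[3+q] q)) (rs-double (3 + q))) (trans (cong rs (4+2q≡2[2+q] q)) (rs-double (2 + q))) ⟩
  rs (3 + q) xor rs (2 + q)
    ≡⟨ sym (cong₂ _xor_ (trans (cong rs (13+4q≡4[3+q]+1 q)) (rs-4n+1 (3 + q))) (trans (cong rs (9+4q≡4[2+q]+1 q)) (rs-4n+1 (2 + q)))) ⟩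
  rs (11 + (suc (q + q) + suc (q + q))) xor rs (7 + (suc (q + q) + suc (q + q))) ∎
  where
  open ≡-Reasoning
  6+2q≡2[3+q] : ∀ q → 5 + suc (q + q) ≡ (3 + q) + (3 + q)
  6+2q≡2[3+q] = solve-∀
  4+2q≡2[2+q] : ∀ q → 3 + suc (q + q) ≡ (2 + q) + (2 + q)
  4+2q≡2[2+q] = solve-∀
  13+4q≡4[3+q]+1 : ∀ q → 11 + (suc (q + q) + suc (q + q)) ≡ suc (((3 + q) + (3 + q)) + ((3 + q) + (3 + q)))
  13+4q≡4[3+q]+1 = solve-∀
  9+4q≡4[2+q]+1 : ∀ q → 7 + (suc (q + q) + suc (q + q)) ≡ suc (((2 + q) + (2 + q)) + ((2 + q) + (2 + q)))
  9+4q≡4[2+q]+1 = solve-∀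

frobenius-quadratic-even : ∀ p → conv ⟦ quadA ⟧ (frobenius T) (8 + (p + p)) ≡ (conv ⟦ quadB ⟧ T ⊕ ⟦ one ⟧) (8 + (p + p))
frobenius-quadratic-even p = begin
  conv ⟦ quadA ⟧ (frobenius T) (8 + (p + p))
    ≡⟨ conv-quadA (frobenius T) (p + p) ⟩
  frobenius T (5 + (p + p)) xor (frobenius T (4 + (p + p)) xor (frobenius T (1 + (p + p)) xor frobenius T (p + p)))
    ≡⟨ cong₂ _xor_ (trans (cong (frobenius T) (5+2p≡1+2[2+p] p)) (frobenius-odd (2 + p) T))
         (cong₂ _xor_ (trans (cong (frobenius T) (4+2p≡2[2+p] p)) (frobenius-even (2 + p) T))
           (cong₂ _xor_ (frobenius-odd p T) (frobenius-even p T))) ⟩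
  rs (5 + p) xor rs (3 + p)
    ≡⟨ T-even-coefficient p ⟩
  rs (11 + (p + p)) xor rs (7 + (p + p))
    ≡⟨ sym (trans (xor-identityʳ _) (conv-quadB T (4 + (p + p)))) ⟩
  (conv ⟦ quadB ⟧ T ⊕ ⟦ one ⟧) (8 + (p + p)) ∎
  where
  open ≡-Reasoning
  5+2p≡1+2[2+p] : ∀ p → 5 + (p + p) ≡ suc ((2 + p) + (2 + p))
  5+2p≡1+2[2+p] = solve-∀
  4+2p≡2[2+p] : ∀ p → 4 + (p + p) ≡ (2 + p) + (2 + p)
  4+2p≡2[2+p] = solve-∀

frobenius-quadratic-odd : ∀ p →
  conv ⟦ quadA ⟧ (frobenius T) (8 + suc (p + p)) ≡ (conv ⟦ quadB ⟧ T ⊕ ⟦ one ⟧) (8 + suc (p + p))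
frobenius-quadratic-odd p = begin
  conv ⟦ quadA ⟧ (frobenius T) (8 + suc (p + p))
    ≡⟨ conv-quadA (frobenius T) (suc (p + p)) ⟩
  frobenius T (5 + suc (p + p)) xor (frobenius T (4 + suc (p + p))
    xor (frobenius T (1 + suc (p + p)) xor frobenius T (suc (p + p))))
    ≡⟨ cong₂ _xor_ (trans (cong (frobenius T) (6+2p≡2[3+p] p)) (frobenius-even (3 + p) T))
         (cong₂ _xor_ (trans (cong (frobenius T) (5+2p≡1+2[2+p] p)) (frobenius-odd (2 + p) T))
           (cong₂ _xor_ (trans (cong (frobenius T) (2+2p≡2[1+p] p)) (frobenius-even (1 + p) T)) (frobenius-odd p T))) ⟩
  rs (6 + p) xor (rs (4 + p) xor false)
    ≡⟨ cong₂ _xor_ (sym (trans (cong rs (12+2p≡2[6+p] p)) (rs-double (6 + p))))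
                   (cong (_xor false) (sym (trans (cong rs (8+2p≡2[4+p] p)) (rs-double (4 + p))))) ⟩
  rs (12 + (p + p)) xor (rs (8 + (p + p)) xor false)
    ≡⟨ cong (rs (12 + (p + p)) xor_) (xor-identityʳ _) ⟩
  rs (12 + (p + p)) xor rs (8 + (p + p))
    ≡⟨ sym (trans (xor-identityʳ _) (conv-quadB T (4 + suc (p + p)))) ⟩
  (conv ⟦ quadB ⟧ T ⊕ ⟦ one ⟧) (8 + suc (p + p)) ∎
  where
  open ≡-Reasoning
  6+2p≡2[3+p] : ∀ p → 5 + suc (p + p) ≡ (3 + p) + (3 + p)
  6+2p≡2[3+p] = solve-∀
  5+2p≡1+2[2+p] : ∀ p → 4 + suc (p + p) ≡ suc ((2 + p) + (2 + p))
  5+2p≡1+2[2+p] = solve-∀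
  2+2p≡2[1+p] : ∀ p → 1 + suc (p + p) ≡ (1 + p) + (1 + p)
  2+2p≡2[1+p] = solve-∀
  12+2p≡2[6+p] : ∀ p → 12 + (p + p) ≡ (6 + p) + (6 + p)
  12+2p≡2[6+p] = solve-∀
  8+2p≡2[4+p] : ∀ p → 8 + (p + p) ≡ (4 + p) + (4 + p)
  8+2p≡2[4+p] = solve-∀

T-quadratic : conv ⟦ quadA ⟧ (conv T T) ≗ conv ⟦ quadB ⟧ T ⊕ ⟦ one ⟧
T-quadratic m = trans (conv-congʳ ⟦ quadA ⟧ (λ i → conv-self≡frobenius i T) m) (frobenius-quadratic m)
  where
  frobenius-quadratic : ∀ m → conv ⟦ quadA ⟧ (frobenius T) m ≡ (conv ⟦ quadB ⟧ T ⊕ ⟦ one ⟧) m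
  frobenius-quadratic 0 = refl
  frobenius-quadratic 1 = refl
  frobenius-quadratic 2 = refl
  frobenius-quadratic 3 = refl
  frobenius-quadratic 4 = refl
  frobenius-quadratic 5 = refl
  frobenius-quadratic 6 = refl
  frobenius-quadratic 7 = refl
  frobenius-quadratic (suc (suc (suc (suc (suc (suc (suc (suc m)))))))) with evenOrOdd m
  ... | is-even p = frobenius-quadratic-even p
  ... | is-odd  p = frobenius-quadratic-odd p

open QuadraticSeries T quadA quadB T-quadratic

State : Set
State = Fin 33

-- The node G = (P T + Q) / (x^valuation (1 + x r)) of the Hankel continued fraction of T,
-- with G = xᵏ / (1 + x u + x^(k+2) G′), where G′ is the node `next`.
record HNode : Set where
  constructor node
  field
    P Q       : Poly
    valuation : ℕ
    r         : Poly
    k         : ℕ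
    u         : Poly
    next      : State
open HNode

hNodes : Vec HNode 33
hNodes =
  node (false ∷ false ∷ true ∷ []) [] 0 [] 2 (false ∷ false ∷ true ∷ []) (# 1)
  ∷ node (true ∷ true ∷ false ∷ false ∷ true ∷ true ∷ []) (true ∷ true ∷ []) 1 [] 2 (false ∷ true ∷ false ∷ []) (# 2)
  ∷ node (true ∷ false ∷ false ∷ false ∷ true ∷ []) (true ∷ []) 1 (true ∷ []) 2 (false ∷ false ∷ false ∷ []) (# 3)
  ∷ node (true ∷ true ∷ false ∷ false ∷ true ∷ true ∷ []) (true ∷ []) 1 [] 0 (false ∷ []) (# 4)
  ∷ node (false ∷ true ∷ true ∷ false ∷ false ∷ true ∷ true ∷ []) (true ∷ true ∷ []) 0 (false ∷ true ∷ false ∷ true ∷ []) 0 (false ∷ []) (# 5)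
  ∷ node (false ∷ true ∷ false ∷ false ∷ false ∷ true ∷ []) (false ∷ true ∷ []) 0 (true ∷ []) 4 (false ∷ false ∷ false ∷ true ∷ false ∷ []) (# 6)
  ∷ node (true ∷ true ∷ false ∷ false ∷ true ∷ true ∷ []) (true ∷ true ∷ []) 3 [] 0 (false ∷ []) (# 7)
  ∷ node (false ∷ true ∷ false ∷ false ∷ false ∷ true ∷ []) (true ∷ []) 0 (true ∷ []) 0 (false ∷ []) (# 8)
  ∷ node (false ∷ true ∷ true ∷ false ∷ false ∷ true ∷ true ∷ []) (false ∷ true ∷ []) 0 (false ∷ true ∷ false ∷ true ∷ []) 2 (false ∷ false ∷ false ∷ []) (# 1)
  ∷ node (false ∷ true ∷ []) [] 0 [] 1 (false ∷ false ∷ []) (# 10)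
  ∷ node (true ∷ true ∷ false ∷ false ∷ true ∷ true ∷ []) (false ∷ true ∷ []) 0 [] 0 (false ∷ []) (# 11)
  ∷ node (false ∷ true ∷ true ∷ false ∷ false ∷ true ∷ true ∷ []) (false ∷ false ∷ true ∷ true ∷ []) 0 (false ∷ false ∷ false ∷ true ∷ true ∷ []) 1 (false ∷ true ∷ []) (# 12)
  ∷ node (true ∷ false ∷ false ∷ false ∷ true ∷ []) (false ∷ true ∷ []) 0 (true ∷ []) 0 (false ∷ []) (# 13)
  ∷ node (false ∷ true ∷ true ∷ false ∷ false ∷ true ∷ true ∷ []) (false ∷ false ∷ true ∷ []) 0 (false ∷ false ∷ false ∷ true ∷ true ∷ []) 1 (false ∷ false ∷ []) (# 14)
  ∷ node (true ∷ true ∷ false ∷ false ∷ true ∷ true ∷ []) [] 0 [] 0 (true ∷ []) (# 15)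
  ∷ node (false ∷ true ∷ true ∷ []) (true ∷ []) 0 (true ∷ []) 0 (false ∷ []) (# 16)
  ∷ node (false ∷ true ∷ true ∷ false ∷ false ∷ true ∷ true ∷ []) (true ∷ false ∷ false ∷ true ∷ true ∷ []) 0 (false ∷ false ∷ false ∷ true ∷ true ∷ []) 0 (true ∷ []) (# 17)
  ∷ node (false ∷ true ∷ true ∷ false ∷ false ∷ true ∷ true ∷ []) (false ∷ true ∷ true ∷ true ∷ []) 0 (true ∷ false ∷ true ∷ true ∷ true ∷ []) 3 (false ∷ false ∷ false ∷ true ∷ []) (# 18)
  ∷ node (true ∷ true ∷ false ∷ false ∷ true ∷ true ∷ []) (true ∷ true ∷ true ∷ []) 2 [] 0 (true ∷ []) (# 19)
  ∷ node (false ∷ true ∷ true ∷ false ∷ false ∷ true ∷ true ∷ []) (true ∷ false ∷ false ∷ true ∷ true ∷ []) 0 (true ∷ false ∷ true ∷ true ∷ true ∷ []) 0 (false ∷ []) (# 20)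
  ∷ node (false ∷ true ∷ true ∷ false ∷ false ∷ true ∷ true ∷ []) (true ∷ false ∷ false ∷ false ∷ true ∷ []) 0 (false ∷ false ∷ false ∷ true ∷ true ∷ []) 0 (true ∷ []) (# 9)
  ∷ node (true ∷ []) [] 0 [] 0 (false ∷ []) (# 22)
  ∷ node (false ∷ true ∷ true ∷ false ∷ false ∷ true ∷ true ∷ []) (false ∷ false ∷ true ∷ []) 0 [] 1 (false ∷ false ∷ []) (# 23)
  ∷ node (true ∷ true ∷ false ∷ false ∷ true ∷ true ∷ []) (false ∷ true ∷ true ∷ []) 0 (false ∷ false ∷ false ∷ true ∷ true ∷ []) 0 (false ∷ []) (# 24)
  ∷ node (false ∷ true ∷ false ∷ false ∷ false ∷ true ∷ []) (true ∷ true ∷ true ∷ []) 0 (true ∷ []) 0 (true ∷ []) (# 25)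
  ∷ node (false ∷ true ∷ true ∷ false ∷ false ∷ true ∷ true ∷ []) (true ∷ true ∷ true ∷ false ∷ false ∷ true ∷ []) 0 (true ∷ true ∷ false ∷ false ∷ true ∷ true ∷ []) 0 (true ∷ []) (# 26)
  ∷ node (false ∷ true ∷ true ∷ true ∷ true ∷ []) (true ∷ []) 0 (true ∷ false ∷ true ∷ true ∷ []) 0 (false ∷ []) (# 27)
  ∷ node (false ∷ true ∷ true ∷ false ∷ false ∷ true ∷ true ∷ []) (true ∷ []) 0 [] 0 (true ∷ []) (# 28)
  ∷ node (false ∷ true ∷ true ∷ false ∷ false ∷ true ∷ true ∷ []) (false ∷ false ∷ false ∷ false ∷ false ∷ true ∷ []) 0 (true ∷ false ∷ false ∷ true ∷ true ∷ true ∷ []) 1 (false ∷ false ∷ []) (# 29)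
  ∷ node (true ∷ true ∷ false ∷ false ∷ true ∷ true ∷ []) (false ∷ false ∷ true ∷ false ∷ true ∷ []) 0 (false ∷ false ∷ false ∷ true ∷ true ∷ []) 0 (true ∷ []) (# 30)
  ∷ node (false ∷ true ∷ true ∷ true ∷ true ∷ []) (false ∷ true ∷ []) 0 (true ∷ false ∷ true ∷ true ∷ []) 2 (false ∷ false ∷ false ∷ []) (# 31)
  ∷ node (true ∷ true ∷ false ∷ false ∷ true ∷ true ∷ []) (true ∷ true ∷ true ∷ []) 1 [] 1 (true ∷ true ∷ []) (# 32)
  ∷ node (true ∷ true ∷ false ∷ false ∷ true ∷ true ∷ []) (true ∷ false ∷ false ∷ false ∷ true ∷ []) 0 (true ∷ false ∷ true ∷ true ∷ true ∷ []) 1 (true ∷ true ∷ []) (# 21)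
  ∷ []

ν : State → HNode
ν = lookup hNodes

nextOf : State → State
nextOf s = next (ν s)

N : State → Poly
N s = xPow*1+x (valuation (ν s)) (r (ν s))

L : State → Series
L s = linear (P (ν s)) (Q (ν s))

G : State → Series
G s = divide (r (ν s)) (λ m → L s (valuation (ν s) + m))

W : State → Poly
W s = mulP quadA (mulP (N s) (N (nextOf s)))

D E : State → Poly
D s = true ∷ u (ν s)
E s = xPow (2 + k (ν s))

L-valuation : ∀ s (i : Fin (valuation (ν s))) → L s (toℕ i) ≡ false
L-valuation = toWitness {a? = all? (λ s → all? (λ i → L s (toℕ i) Boolₚ.≟ false))} _

W-nonzero : ∀ s → isZero (W s) ≡ false
W-nonzero = toWitness {a? = all? (λ s → isZero (W s) Boolₚ.≟ false)} _

coeffT coeff1 : State → Poly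
coeffT s = stepCoeffT (N (nextOf s)) (D s) (P (ν s)) (Q (ν s)) (P (ν (nextOf s))) (Q (ν (nextOf s))) (E s)
coeff1 s = stepCoeff1 (N (nextOf s)) (D s) (P (ν s)) (Q (ν s)) (P (ν (nextOf s))) (Q (ν (nextOf s))) (E s)

coeffT≡0 : ∀ s → isZero (coeffT s) ≡ true
coeffT≡0 = toWitness {a? = all? (λ s → isZero (coeffT s) Boolₚ.≟ true)} _

coeff1≡Wxᵏ : ∀ s → isZero (addP (coeff1 s) (mulP (W s) (xPow (k (ν s))))) ≡ true
coeff1≡Wxᵏ = toWitness {a? = all? (λ s → isZero (addP (coeff1 s) (mulP (W s) (xPow (k (ν s))))) Boolₚ.≟ true)} _

u-short : ∀ s → length (u (ν s)) ≤ suc (k (ν s))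
u-short = toWitness {a? = all? (λ s → length (u (ν s)) ≤? suc (k (ν s)))} _

N*G≡L : ∀ s → conv ⟦ N s ⟧ (G s) ≗ L s
N*G≡L s = conv-divide-xPow (valuation (ν s)) (r (ν s)) (L s)
  (λ i i<v → trans (cong (L s) (sym (toℕ-fromℕ< i<v))) (L-valuation s (fromℕ< i<v)))

module NodeStep (s : State) = HFractionStep
  (N s) (P (ν s)) (Q (ν s)) (N (nextOf s)) (P (ν (nextOf s))) (Q (ν (nextOf s))) (D s) (E s)
  (G s) (G (nextOf s)) (N*G≡L s) (N*G≡L (nextOf s)) (k (ν s)) (W-nonzero s) (coeffT≡0 s) (coeff1≡Wxᵏ s)

d-tail : ∀ s m → NodeStep.d s (2 + k (ν s) + m) ≡ G (nextOf s) m
d-tail s m = cong₂ _xor_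
  (⟦⟧-beyondLength (u (ν s)) (suc (k (ν s) + m)) (ℕₚ.≤-trans (u-short s) (s≤s (ℕₚ.m≤m+n (k (ν s)) m))))
  (conv-xPow (2 + k (ν s)) (G (nextOf s)) m)

module NodeReduction (s : State) = HankelReduction
  (G s) (G (nextOf s)) (NodeStep.d s) (k (ν s)) refl (d-tail s) (NodeStep.d*G≡xᵏ s)

open AutomatonProfile (k ∘ ν) nextOf

hankel₂-G-isProfile : IsProfile (λ s n → hankel₂ (G s) n)
hankel₂-G-isProfile = record
  { at-0      = λ s → refl
  ; gap       = NodeReduction.hankel₂-vanish
  ; after-gap = NodeReduction.hankel₂-reduce
  }

hankel₂-G-periodic : ∀ s n → hankel₂ (G s) n ≡ unfold 40 s (n % 18)
hankel₂-G-periodic = profile-unique hankel₂-G-isProfile (periodic-isProfile 39 17 k<18 consistent)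
  where
  k<18 : ∀ s → k (ν s) < 18
  k<18 = toWitness {a? = all? (λ s → k (ν s) <? 18)} _
  consistent : ∀ s (r : Fin 18) → unfold 40 s ((suc (k (ν s)) + toℕ r) % 18) ≡ unfold 40 (nextOf s) (toℕ r)
  consistent = toWitness {a? = all? (λ s → all? (λ r →
            unfold 40 s ((suc (k (ν s)) + toℕ r) % 18) Boolₚ.≟ unfold 40 (nextOf s) (toℕ r)))} _

G≗L : ∀ s → N s ≡ one → G s ≗ L s
G≗L s N≡1 m = trans (sym (conv-identityˡ (G s) m)) (trans (conv-congˡ (G s) (λ i → cong (λ p → ⟦ p ⟧ i) (sym N≡1)) m) (N*G≡L s m))

G₀≡shift₁ : ∀ m → G (# 0) m ≡ rs (m + 1)
G₀≡shift₁ m = trans (G≗L (# 0) refl m) (L₀ m)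
  where
  L₀ : ∀ m → L (# 0) m ≡ rs (m + 1)
  L₀ zero          = refl
  L₀ (suc zero)    = refl
  L₀ (suc (suc m)) = trans (xor-identityʳ _) (trans (conv-xPow 2 T m) (cong rs (3+m≡[2+m]+1 m)))
    where
    3+m≡[2+m]+1 : ∀ m → 3 + m ≡ suc (suc m) + 1
    3+m≡[2+m]+1 = solve-∀

G₉≡shift₂ : ∀ m → G (# 9) m ≡ rs (m + 2)
G₉≡shift₂ m = trans (G≗L (# 9) refl m) (L₉ m)
  where
  L₉ : ∀ m → L (# 9) m ≡ rs (m + 2)
  L₉ zero    = refl
  L₉ (suc m) = trans (xor-identityʳ _) (trans (conv-xPow 1 T m) (cong rs (3+m≡[1+m]+2 m)))
    where
    3+m≡[1+m]+2 : ∀ m → 3 + m ≡ suc m + 2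
    3+m≡[1+m]+2 = solve-∀

G₂₁≡shift₃ : ∀ m → G (# 21) m ≡ rs (m + 3)
G₂₁≡shift₃ m = trans (G≗L (# 21) refl m)
  (trans (xor-identityʳ _) (trans (conv-identityˡ T m) (cong rs (ℕₚ.+-comm 3 m))))

module RudinShapiro (u : ℕ → ℤ) (u-0 : u 0 ≡ 0ℤ) (u-2n : ∀ n → u (2 * n) ≡ u n)
                    (u-4n+1 : ∀ n → u (4 * n + 1) ≡ u n) (u-4n+3 : ∀ n → u (4 * n + 3) ≡ 1ℤ - u (2 * n + 1)) where

  parity-u : ∀ n → parity (u n) ≡ rs n
  parity-u = <-rec _ step
    where
    2*n≡n+n : ∀ n → 2 * n ≡ n + n
    2*n≡n+n = solve-∀
    4*n+1≡1+4n : ∀ n → 4 * n + 1 ≡ suc ((n + n) + (n + n))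
    4*n+1≡1+4n = solve-∀
    4*n+3≡3+4n : ∀ n → 4 * n + 3 ≡ 3 + ((n + n) + (n + n))
    4*n+3≡3+4n = solve-∀
    2*n+1≡1+2n : ∀ n → 2 * n + 1 ≡ suc (n + n)
    2*n+1≡1+2n = solve-∀
    1+2[1+2n]≡3+4n : ∀ n → suc (suc (n + n) + suc (n + n)) ≡ 3 + ((n + n) + (n + n))
    1+2[1+2n]≡3+4n = solve-∀
    parity-1- : ∀ x → parity (1ℤ - x) ≡ not (parity x)
    parity-1- x = trans (parity-+ 1ℤ (ℤ.- x)) (cong not (parity-neg x))

    step : ∀ n → (∀ {m} → m < n → parity (u m) ≡ rs m) → parity (u n) ≡ rs n
    step n ih with evenOrOdd n
    ... | is-even zero    = cong parity u-0
    ... | is-even (suc p) = begin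
      parity (u (suc p + suc p))  ≡⟨ cong parity (trans (cong u (sym (2*n≡n+n (suc p)))) (u-2n (suc p))) ⟩
      parity (u (suc p))          ≡⟨ ih (s≤s (ℕₚ.m≤n+m (suc p) p)) ⟩
      rs (suc p)                  ≡⟨ sym (rs-double (suc p)) ⟩
      rs (suc p + suc p)          ∎
      where open ≡-Reasoning
    ... | is-odd p with evenOrOdd p
    ...   | is-even q = begin
      parity (u (suc ((q + q) + (q + q))))  ≡⟨ cong parity (trans (cong u (sym (4*n+1≡1+4n q))) (u-4n+1 q)) ⟩
      parity (u q)                          ≡⟨ ih (s≤s (ℕₚ.≤-trans (ℕₚ.m≤m+n q q) (ℕₚ.m≤m+n (q + q) (q + q)))) ⟩
      rs q                                  ≡⟨ sym (rs-4n+1 q) ⟩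
      rs (suc ((q + q) + (q + q)))          ∎
      where open ≡-Reasoning
    ...   | is-odd q = begin
      parity (u (suc (suc (q + q) + suc (q + q))))
        ≡⟨ cong parity (trans (cong u (trans (1+2[1+2n]≡3+4n q) (sym (4*n+3≡3+4n q)))) (u-4n+3 q)) ⟩
      parity (1ℤ - u (2 * q + 1))
        ≡⟨ parity-1- (u (2 * q + 1)) ⟩
      not (parity (u (2 * q + 1)))
        ≡⟨ cong (λ m → not (parity (u m))) (2*n+1≡1+2n q) ⟩
      not (parity (u (suc (q + q))))
        ≡⟨ cong not (ih (s≤s (s≤s (ℕₚ.m≤m+n (q + q) (suc (q + q)))))) ⟩
      not (rs (suc (q + q)))
        ≡⟨ sym (rs-4n+3 q) ⟩
      rs (3 + ((q + q) + (q + q)))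
        ≡⟨ cong rs (sym (1+2[1+2n]≡3+4n q)) ⟩
      rs (suc (suc (q + q) + suc (q + q))) ∎
      where open ≡-Reasoning

H%2≡profile : ∀ (a : ℕ → ℤ) s → (∀ i → parity (a i) ≡ G s i) → ∀ n → H a n %ℕ 2 ≡ bit (unfold 40 s (n % 18))
H%2≡profile a s parity-a≡G n = begin
  H a n %ℕ 2                     ≡⟨ H%2≡hankel₂ a n ⟩
  bit (hankel₂ (parity ∘ a) n)   ≡⟨ cong bit (det₂-cong n (λ i j → parity-a≡G (toℕ i + toℕ j))) ⟩
  bit (hankel₂ (G s) n)          ≡⟨ cong bit (hankel₂-G-periodic s n) ⟩
  bit (unfold 40 s (n % 18))     ∎
  where open ≡-Reasoning

H%2-periodic : ∀ (a : ℕ → ℤ) s (w : Vec ℕ 18) → (∀ i → parity (a i) ≡ G s i) →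
  True (all? (λ i → bit (unfold 40 s (toℕ i)) ℕ.≟ lookup w i)) → ∀ n → H a n %ℕ 2 ≡ periodic w n
H%2-periodic a s w parity-a≡G table n = begin
  H a n %ℕ 2                   ≡⟨ H%2≡profile a s parity-a≡G n ⟩
  bit (unfold 40 s (n % 18))   ≡⟨ cong (bit ∘ unfold 40 s) (sym (toℕ-fromℕ< (m%n<n n 18))) ⟩
  bit (unfold 40 s (toℕ i))    ≡⟨ toWitness table i ⟩
  lookup w i                   ∎
  where
  open ≡-Reasoning
  i = fromℕ< (m%n<n n 18)

proposition1p3 : (u : ℕ → ℤ)
    → u 0 ≡ 0ℤ
    → (∀ n → u (2 * n) ≡ u n)
    → (∀ n → u (4 * n + 1) ≡ u n)
    → (∀ n → u (4 * n + 3) ≡ 1ℤ - u (2 * n + 1))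
    → (∀ n → H (λ i → u (i + 1)) n %ℕ 2
          ≡ periodic (1 ∷ 0 ∷ 0 ∷ 1 ∷ 0 ∷ 0 ∷ 1 ∷ 0 ∷ 0 ∷ 1 ∷ 1 ∷ 1 ∷ 0 ∷ 0 ∷ 0 ∷ 0 ∷ 1 ∷ 1 ∷ []) n)
    × (∀ n → H (λ i → u (i + 2)) n %ℕ 2
          ≡ periodic (1 ∷ 0 ∷ 1 ∷ 1 ∷ 0 ∷ 1 ∷ 1 ∷ 0 ∷ 1 ∷ 1 ∷ 1 ∷ 1 ∷ 0 ∷ 0 ∷ 0 ∷ 1 ∷ 1 ∷ 1 ∷ []) n)
    × (∀ n → H (λ i → u (i + 3)) n %ℕ 2
          ≡ periodic (1 ∷ 1 ∷ 0 ∷ 1 ∷ 1 ∷ 1 ∷ 1 ∷ 1 ∷ 1 ∷ 0 ∷ 1 ∷ 1 ∷ 0 ∷ 0 ∷ 1 ∷ 0 ∷ 1 ∷ 0 ∷ []) n)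
proposition1p3 u u-0 u-2n u-4n+1 u-4n+3 =
    H%2-periodic (λ i → u (i + 1)) (# 0)
      (1 ∷ 0 ∷ 0 ∷ 1 ∷ 0 ∷ 0 ∷ 1 ∷ 0 ∷ 0 ∷ 1 ∷ 1 ∷ 1 ∷ 0 ∷ 0 ∷ 0 ∷ 0 ∷ 1 ∷ 1 ∷ [])
      (λ i → trans (parity-u (i + 1)) (sym (G₀≡shift₁ i))) _
  , H%2-periodic (λ i → u (i + 2)) (# 9)
      (1 ∷ 0 ∷ 1 ∷ 1 ∷ 0 ∷ 1 ∷ 1 ∷ 0 ∷ 1 ∷ 1 ∷ 1 ∷ 1 ∷ 0 ∷ 0 ∷ 0 ∷ 1 ∷ 1 ∷ 1 ∷ [])
      (λ i → trans (parity-u (i + 2)) (sym (G₉≡shift₂ i))) _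
  , H%2-periodic (λ i → u (i + 3)) (# 21)
      (1 ∷ 1 ∷ 0 ∷ 1 ∷ 1 ∷ 1 ∷ 1 ∷ 1 ∷ 1 ∷ 0 ∷ 1 ∷ 1 ∷ 0 ∷ 0 ∷ 1 ∷ 0 ∷ 1 ∷ 0 ∷ [])
      (λ i → trans (parity-u (i + 3)) (sym (G₂₁≡shift₃ i))) _
  where open RudinShapiro u u-0 u-2n u-4n+1 u-4n+3
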